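{- For $n\ge 6$ there is no tight irreducible affine vector space partition of $\mathrm{PG}(n-1,2)$ of type $(n-2)^2(n-3)^4$ (i.e. consisting of exactly two subspaces of dimension $n-2$ and four subspaces of dimension $n-3$).
   Context: $\mathrm{PG}(n-1,q)$ denotes the projective geometry of $\mathbb{F}_q^n$; all dimensions are algebraic (vector space) dimensions, so points are $1$-dimensional subspaces and hyperplanes are $(n-1)$-dimensional subspaces. An affine vector space partition (avsp) of $\mathrm{PG}(n-1,q)$ is a set $\mathcal{U}=\{U_1,\dots,U_r\}$ of subspaces with $1\le \dim U_i\le n-1$ for which there exists a hyperplane $H_\infty$ such that no $U_i$ is contained in $H_\infty$ and every point not contained in $H_\infty$ is contained in exactly one $U_i$. For a subspace $W\not\le H_\infty$, a set of subspaces of $W$ none of which lies in $H_\infty$ is an avsp of $W$ if every point of $W$ outside $H_\infty$ lies in exactly one of them. $\mathcal{U}$ is reducible if there exist a subspace $W$ with $\dim W<n$ and a subset $S\subsetneq\{1,\dots,r\}$ with $|S|>1$ such that $\{U_i: i\in S\}$ is an avsp of $W$; otherwise it is irreducible. $\mathcal{U}$ is tight if $U_1\cap\cdots\cap U_r$ is the zero subspace. -}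

module Defs where

open import Data.Bool using (Bool; true; false; _xor_; if_then_else_)
open import Data.Nat using (ℕ; zero; suc; _+_; _^_; _<_; _≤_; _∸_)
open import Data.Fin using (Fin)
open import Data.Vec using (Vec; []; _∷_; replicate; zipWith)
open import Data.List using (List; []; _∷_; _++_; map)
open import Data.Nat.ListAction using (sum)
open import Data.Product using (Σ; ∃; _×_)
open import Relation.Binary.PropositionalEquality using (_≡_)
open import Relation.Nullary using (¬_)

-- Vectors of F_2^n : F_2 = Bool, addition = xor.
V : ℕ → Set
V n = Vec Bool n

0v : (n : ℕ) → V n
0v n = replicate n false

_⊕_ : {n : ℕ} → V n → V n → V n
_⊕_ = zipWith _xor_

-- A subspace of F_2^n: a (decidable) subset containing 0, closed under
-- addition (scalar multiplication over F_2 is then automatic).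
record Subspace (n : ℕ) : Set where
  field
    mem     : V n → Bool
    hasZero : mem (0v n) ≡ true
    closed  : ∀ u v → mem u ≡ true → mem v ≡ true → mem (u ⊕ v) ≡ true
open Subspace public

_∈_ : {n : ℕ} → V n → Subspace n → Set
v ∈ U = mem U v ≡ true

_∉_ : {n : ℕ} → V n → Subspace n → Set
v ∉ U = ¬ (v ∈ U)

_⊆_ : {n : ℕ} → Subspace n → Subspace n → Set
U ⊆ W = ∀ v → v ∈ U → v ∈ W

allVecs : (n : ℕ) → List (V n)
allVecs zero = [] ∷ []
allVecs (suc n) = map (false ∷_) (allVecs n) ++ map (true ∷_) (allVecs n)

card : {n : ℕ} → Subspace n → ℕ
card {n} U = sum (map (λ v → if mem U v then 1 else 0) (allVecs n))

-- (algebraic) dimension: U has dimension d iff |U| = 2^d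
HasDim : {n : ℕ} → Subspace n → ℕ → Set
HasDim U d = card U ≡ 2 ^ d

-- Points of PG(n-1,2) are the 1-dim subspaces, i.e. the nonzero vectors;
-- a point v lies in U iff v ∈ U.
IsPoint : {n : ℕ} → V n → Set
IsPoint {n} v = ¬ (v ≡ 0v n)

ExactlyOne : {n r : ℕ} → (Fin r → Bool) → (Fin r → Subspace n) → V n → Set
ExactlyOne S U v =
  Σ _ (λ i → S i ≡ true × v ∈ U i) ×
  (∀ i j → S i ≡ true → S j ≡ true → v ∈ U i → v ∈ U j → i ≡ j)

IsAVSPof : {n r : ℕ} → Subspace n → Subspace n → (Fin r → Bool) → (Fin r → Subspace n) → Set
IsAVSPof H W S U =
  ¬ (W ⊆ H) ×
  (∀ i → S i ≡ true → (U i ⊆ W) × ¬ (U i ⊆ H)) ×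
  (∀ v → IsPoint v → v ∈ W → v ∉ H → ExactlyOne S U v)

full : {n : ℕ} → Subspace n
full = record { mem = λ _ → true ; hasZero = _≡_.refl ; closed = λ _ _ _ _ → _≡_.refl }

allS : {r : ℕ} → Fin r → Bool
allS _ = true

IsAVSP : {n r : ℕ} → Subspace n → (Fin r → Subspace n) → Set
IsAVSP {n} H U =
  HasDim H (n ∸ 1) ×
  (∀ i → Σ ℕ (λ d → HasDim (U i) d × 1 ≤ d × d ≤ n ∸ 1)) ×
  IsAVSPof H full allS U

size : {r : ℕ} → (Fin r → Bool) → ℕ
size {zero} S = 0
size {suc r} S = (if S Fin.zero then 1 else 0) + size (λ i → S (Fin.suc i))

Reducible : {n r : ℕ} → Subspace n → (Fin r → Subspace n) → Set
Reducible {n} {r} H U =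
  Σ (Subspace n) λ W → Σ (Fin r → Bool) λ S →
    Σ ℕ (λ d → HasDim W d × d < n) ×
    1 < size S × size S < r ×
    IsAVSPof H W S U

Irreducible : {n r : ℕ} → Subspace n → (Fin r → Subspace n) → Set
Irreducible H U = ¬ Reducible H U

Tight : {n r : ℕ} → (Fin r → Subspace n) → Set
Tight {n} U = ∀ v → (∀ i → v ∈ U i) → v ≡ 0v n

-- Write H for the hyperplane at infinity, U₀, U₁ for the two members of
-- dimension n − 2, S₀, …, S₃ for the four of dimension n − 3, and
-- D_s = U_s ∩ H, E_i = S_i ∩ H.  If D₁ ⊆ D₀, then U₀ + ⟨q⟩ for an affine
-- q ∈ U₁ is a hyperplane whose affine part is partitioned by U₀ and U₁,
-- against irreducibility.  Otherwise K = D₀ + D₁ is a hyperplane of H and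
-- the affine points fall into the two cosets C_s = p_s + K (p_s ∈ U_s ∖ H).
-- The part B_s = C_s ∖ U_s is a coset of D_s that the Sᵢ must cover.  If
-- the affine part of some Sᵢ lies in one coset, counting inside B_s either
-- gives a second such S_j, and then Sᵢ, S_j partition D_s + B_s, or it
-- produces a nonzero vector of G_j = E_j ∩ K lying in all six members,
-- against tightness.  Otherwise every Sᵢ meets both cosets; then each
-- G_i has index two in J = D₀ ∩ D₁ and every coset pᵢ + J is covered by Sᵢ
-- and one partner S_j.  Comparing the partners of S₀ on the two sides gives
-- again either a reducing pair or a nonzero vector common to all members.

module Submission where

open import Defs
open import Data.Bool using (Bool; true; false; not; _∧_; _∨_; _xor_; if_then_else_)
open import Data.Bool.Properties using (xor-assoc; xor-comm; xor-same; xor-identityˡ; xor-identityʳ)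
  renaming (_≟_ to _≟ᵇ_)
open import Data.Empty using (⊥; ⊥-elim)
open import Data.Fin using (Fin; zero; suc)
open import Data.Fin.Properties using (all?) renaming (_≟_ to _≟ᶠ_)
open import Data.List using (List; []; _∷_; _++_; map)
open import Data.List.Properties using (map-++; map-∘)
open import Data.Nat using (ℕ; zero; suc; _+_; _*_; _^_; _<_; _≤_; _∸_; z≤n; s≤s)
open import Data.Nat.ListAction using (sum)
open import Data.Nat.ListAction.Properties using (sum-++)
open import Data.Nat.Properties
open import Function using (_∘_)
open import Data.Product using (Σ; _×_; _,_; proj₁; proj₂)
open import Data.Sum using (_⊎_; inj₁; inj₂)
import Data.Sum
open import Data.Vec using (Vec; []; _∷_; lookup; replicate; zipWith)
open import Data.Vec.Properties using (zipWith-assoc; zipWith-comm; zipWith-identityˡ; zipWith-identityʳ)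
open import Relation.Binary.PropositionalEquality hiding (J)
open import Relation.Nullary using (¬_; Dec; yes; no; does)
open import Relation.Nullary.Decidable using (dec-true; ¬?; _→-dec_; from-yes)

private
  variable
    n m : ℕ
    a b : Bool
    x y : V n
    i : Fin 4

∧-true⁺ : a ≡ true → b ≡ true → a ∧ b ≡ true
∧-true⁺ refl refl = refl

∧-true⁻ˡ : a ∧ b ≡ true → a ≡ true
∧-true⁻ˡ {true} _ = refl

∧-true⁻ʳ : a ∧ b ≡ true → b ≡ true
∧-true⁻ʳ {true} p = p

∨-true⁺ˡ : a ≡ true → a ∨ b ≡ true
∨-true⁺ˡ refl = refl

∨-true⁺ʳ : b ≡ true → a ∨ b ≡ true
∨-true⁺ʳ {a = true} _ = refl
∨-true⁺ʳ {a = false} p = p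

∨-true⁻ : a ∨ b ≡ true → a ≡ true ⊎ b ≡ true
∨-true⁻ {true} _ = inj₁ refl
∨-true⁻ {false} p = inj₂ p

not-true⁺ : ¬ a ≡ true → not a ≡ true
not-true⁺ {false} _ = refl
not-true⁺ {true} ¬p = ⊥-elim (¬p refl)

not-true⁻ : not a ≡ true → ¬ a ≡ true
not-true⁻ {false} _ ()

true-⇔⇒≡ : (a ≡ true → b ≡ true) → (b ≡ true → a ≡ true) → a ≡ b
true-⇔⇒≡ {false} {false} _ _ = refl
true-⇔⇒≡ {false} {true} _ g = g refl
true-⇔⇒≡ {true} {false} f _ = sym (f refl)
true-⇔⇒≡ {true} {true} _ _ = refl


-- F₂ⁿ as an elementary abelian 2-group

⊕-assoc : (x y z : V n) → (x ⊕ y) ⊕ z ≡ x ⊕ (y ⊕ z)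
⊕-assoc = zipWith-assoc xor-assoc

⊕-comm : (x y : V n) → x ⊕ y ≡ y ⊕ x
⊕-comm = zipWith-comm xor-comm

⊕-identityˡ : (x : V n) → 0v n ⊕ x ≡ x
⊕-identityˡ = zipWith-identityˡ xor-identityˡ

⊕-identityʳ : (x : V n) → x ⊕ 0v n ≡ x
⊕-identityʳ = zipWith-identityʳ xor-identityʳ

⊕-self : (x : V n) → x ⊕ x ≡ 0v n
⊕-self [] = refl
⊕-self (b ∷ x) = cong₂ _∷_ (xor-same b) (⊕-self x)

-- Two sums are equal iff every variable occurs in both with the same
-- parity; the normal form of an expression records these parities.
module ⊕-Solver where

  infixl 6 _⊞_
  data Expr (m : ℕ) : Set where
    var : Fin m → Expr m
    _⊞_ : Expr m → Expr m → Expr m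

  v₀ : Expr (suc m)
  v₀ = var zero

  v₁ : Expr (suc (suc m))
  v₁ = var (suc zero)

  v₂ : Expr (suc (suc (suc m)))
  v₂ = var (suc (suc zero))

  ⟦_⟧ : Expr m → Vec (V n) m → V n
  ⟦ var i ⟧ ρ = lookup ρ i
  ⟦ e ⊞ f ⟧ ρ = ⟦ e ⟧ ρ ⊕ ⟦ f ⟧ ρ

  parity : Expr m → Vec Bool m
  parity (var zero) = true ∷ replicate _ false
  parity (var (suc i)) = false ∷ parity (var i)
  parity (e ⊞ f) = zipWith _xor_ (parity e) (parity f)

  _·_ : Bool → V n → V n
  true · x = x
  false · x = 0v _

  ⟦_⟧ᴾ : Vec Bool m → Vec (V n) m → V n
  ⟦ [] ⟧ᴾ [] = 0v _
  ⟦ b ∷ bs ⟧ᴾ (x ∷ ρ) = (b · x) ⊕ ⟦ bs ⟧ᴾ ρ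

  ⊕-interchange : (x y z w : V n) → (x ⊕ y) ⊕ (z ⊕ w) ≡ (x ⊕ z) ⊕ (y ⊕ w)
  ⊕-interchange x y z w = begin
    (x ⊕ y) ⊕ (z ⊕ w)  ≡⟨ ⊕-assoc x y (z ⊕ w) ⟩
    x ⊕ (y ⊕ (z ⊕ w))  ≡⟨ cong (x ⊕_) (sym (⊕-assoc y z w)) ⟩
    x ⊕ ((y ⊕ z) ⊕ w)  ≡⟨ cong (λ t → x ⊕ (t ⊕ w)) (⊕-comm y z) ⟩
    x ⊕ ((z ⊕ y) ⊕ w)  ≡⟨ cong (x ⊕_) (⊕-assoc z y w) ⟩
    x ⊕ (z ⊕ (y ⊕ w))  ≡⟨ sym (⊕-assoc x z (y ⊕ w)) ⟩
    (x ⊕ z) ⊕ (y ⊕ w)  ∎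
    where open ≡-Reasoning

  ·-distrib-xor : ∀ b c (x : V n) → (b xor c) · x ≡ (b · x) ⊕ (c · x)
  ·-distrib-xor false c x = sym (⊕-identityˡ _)
  ·-distrib-xor true false x = sym (⊕-identityʳ x)
  ·-distrib-xor true true x = sym (⊕-self x)

  ⟦replicate⟧ᴾ : (ρ : Vec (V n) m) → ⟦ replicate m false ⟧ᴾ ρ ≡ 0v n
  ⟦replicate⟧ᴾ [] = refl
  ⟦replicate⟧ᴾ (x ∷ ρ) = trans (⊕-identityˡ _) (⟦replicate⟧ᴾ ρ)

  ⟦zipWith⟧ᴾ : (bs cs : Vec Bool m) (ρ : Vec (V n) m) →
    ⟦ zipWith _xor_ bs cs ⟧ᴾ ρ ≡ ⟦ bs ⟧ᴾ ρ ⊕ ⟦ cs ⟧ᴾ ρ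
  ⟦zipWith⟧ᴾ [] [] [] = sym (⊕-self _)
  ⟦zipWith⟧ᴾ (b ∷ bs) (c ∷ cs) (x ∷ ρ) =
    trans (cong₂ _⊕_ (·-distrib-xor b c x) (⟦zipWith⟧ᴾ bs cs ρ)) (⊕-interchange _ _ _ _)

  ⟦parity⟧ : (e : Expr m) (ρ : Vec (V n) m) → ⟦ parity e ⟧ᴾ ρ ≡ ⟦ e ⟧ ρ
  ⟦parity⟧ (var zero) (x ∷ ρ) = trans (cong (x ⊕_) (⟦replicate⟧ᴾ ρ)) (⊕-identityʳ x)
  ⟦parity⟧ (var (suc i)) (x ∷ ρ) = trans (⊕-identityˡ _) (⟦parity⟧ (var i) ρ)
  ⟦parity⟧ (e ⊞ f) ρ = trans (⟦zipWith⟧ᴾ (parity e) (parity f) ρ) (cong₂ _⊕_ (⟦parity⟧ e ρ) (⟦parity⟧ f ρ))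

  solve : (e f : Expr m) → parity e ≡ parity f → (ρ : Vec (V n) m) → ⟦ e ⟧ ρ ≡ ⟦ f ⟧ ρ
  solve e f eq ρ = trans (sym (⟦parity⟧ e ρ)) (trans (cong (λ bs → ⟦ bs ⟧ᴾ ρ) eq) (⟦parity⟧ f ρ))

open ⊕-Solver using (v₀; v₁; v₂; _⊞_; solve)

⊕-cancelˡ : (x y : V n) → x ⊕ (x ⊕ y) ≡ y
⊕-cancelˡ x y = solve (v₀ ⊞ (v₀ ⊞ v₁)) v₁ refl (x ∷ y ∷ [])

⊕-cancelʳ : (x y : V n) → (y ⊕ x) ⊕ x ≡ y
⊕-cancelʳ x y = solve ((v₁ ⊞ v₀) ⊞ v₀) v₁ refl (x ∷ y ∷ [])

-- Subspaces

module _ (U : Subspace n) where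

  ∈-resp-≡ : x ≡ y → x ∈ U → y ∈ U
  ∈-resp-≡ eq = subst (_∈ U) eq

  ∈-⊕ : x ∈ U → y ∈ U → (x ⊕ y) ∈ U
  ∈-⊕ {x} {y} = closed U x y

  ∈-⊕⁻ʳ : x ∈ U → (x ⊕ y) ∈ U → y ∈ U
  ∈-⊕⁻ʳ {x} {y} x∈U x⊕y∈U = ∈-resp-≡ (⊕-cancelˡ x y) (closed U _ _ x∈U x⊕y∈U)

  ∈-⊕⁻ˡ : y ∈ U → (x ⊕ y) ∈ U → x ∈ U
  ∈-⊕⁻ˡ {y} {x} y∈U x⊕y∈U = ∈-resp-≡ (⊕-cancelʳ y x) (closed U _ _ x⊕y∈U y∈U)

  ∉-⊕ : x ∉ U → y ∈ U → (x ⊕ y) ∉ U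
  ∉-⊕ x∉U y∈U x⊕y∈U = x∉U (∈-⊕⁻ˡ y∈U x⊕y∈U)

infixl 30 _∩_
_∩_ : Subspace n → Subspace n → Subspace n
U ∩ W = record
  { mem = λ v → mem U v ∧ mem W v
  ; hasZero = ∧-true⁺ (hasZero U) (hasZero W)
  ; closed = λ u v u∈ v∈ →
      ∧-true⁺ (closed U u v (∧-true⁻ˡ u∈) (∧-true⁻ˡ v∈)) (closed W u v (∧-true⁻ʳ u∈) (∧-true⁻ʳ v∈))
  }

module _ (U W : Subspace n) where

  ∈-∩⁺ : x ∈ U → x ∈ W → x ∈ U ∩ W
  ∈-∩⁺ = ∧-true⁺

  ∈-∩⁻ˡ : x ∈ U ∩ W → x ∈ U
  ∈-∩⁻ˡ = ∧-true⁻ˡ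

  ∈-∩⁻ʳ : x ∈ U ∩ W → x ∈ W
  ∈-∩⁻ʳ {x = x} = ∧-true⁻ʳ {mem U x}

infix 30 _+⟨_⟩
_+⟨_⟩ : Subspace n → V n → Subspace n
X +⟨ c ⟩ = record
  { mem = λ v → mem X v ∨ mem X (v ⊕ c)
  ; hasZero = ∨-true⁺ˡ (hasZero X)
  ; closed = λ u v u∈ v∈ → ∈-sum (∨-true⁻ u∈) (∨-true⁻ v∈)
  }
  where
  ∈-sum : ∀ {u v} → u ∈ X ⊎ (u ⊕ c) ∈ X → v ∈ X ⊎ (v ⊕ c) ∈ X →
          (mem X (u ⊕ v) ∨ mem X ((u ⊕ v) ⊕ c)) ≡ true
  ∈-sum {u} {v} (inj₁ u∈) (inj₁ v∈) = ∨-true⁺ˡ (∈-⊕ X u∈ v∈)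
  ∈-sum {u} {v} (inj₁ u∈) (inj₂ v∈) =
    ∨-true⁺ʳ (∈-resp-≡ X (solve (v₀ ⊞ (v₁ ⊞ v₂)) ((v₀ ⊞ v₁) ⊞ v₂) refl (u ∷ v ∷ c ∷ [])) (∈-⊕ X u∈ v∈))
  ∈-sum {u} {v} (inj₂ u∈) (inj₁ v∈) =
    ∨-true⁺ʳ (∈-resp-≡ X (solve ((v₀ ⊞ v₂) ⊞ v₁) ((v₀ ⊞ v₁) ⊞ v₂) refl (u ∷ v ∷ c ∷ [])) (∈-⊕ X u∈ v∈))
  ∈-sum {u} {v} (inj₂ u∈) (inj₂ v∈) =
    ∨-true⁺ˡ (∈-resp-≡ X (solve ((v₀ ⊞ v₂) ⊞ (v₁ ⊞ v₂)) (v₀ ⊞ v₁) refl (u ∷ v ∷ c ∷ [])) (∈-⊕ X u∈ v∈))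

module _ (X : Subspace n) (c : V n) where

  ∈-+⟨⟩⁺ˡ : x ∈ X → x ∈ X +⟨ c ⟩
  ∈-+⟨⟩⁺ˡ = ∨-true⁺ˡ

  ∈-+⟨⟩⁺ʳ : (x ⊕ c) ∈ X → x ∈ X +⟨ c ⟩
  ∈-+⟨⟩⁺ʳ {x = x} = ∨-true⁺ʳ {a = mem X x}

  ∈-+⟨⟩⁻ : x ∈ X +⟨ c ⟩ → x ∈ X ⊎ (x ⊕ c) ∈ X
  ∈-+⟨⟩⁻ = ∨-true⁻

∈-+⟨self⟩ : (X : Subspace n) (c : V n) → c ∈ X +⟨ c ⟩
∈-+⟨self⟩ X c = ∈-+⟨⟩⁺ʳ X c (∈-resp-≡ X (sym (⊕-self c)) (hasZero X))

-- Counting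

Pred : ℕ → Set
Pred n = V n → Bool

infixl 30 _∩ᵖ_ _∖ᵖ_
infix 4 _⊆ᵖ_

_∩ᵖ_ : Pred n → Pred n → Pred n
(P ∩ᵖ Q) x = P x ∧ Q x

_∖ᵖ_ : Pred n → Pred n → Pred n
(P ∖ᵖ Q) x = P x ∧ not (Q x)

_⊆ᵖ_ : Pred n → Pred n → Set
P ⊆ᵖ Q = ∀ x → P x ≡ true → Q x ≡ true

isZero : V n → Bool
isZero [] = true
isZero (b ∷ v) = not b ∧ isZero v

isZero-0v : ∀ n → isZero (0v n) ≡ true
isZero-0v zero = refl
isZero-0v (suc n) = isZero-0v n

private
  countL : {A : Set} → (A → Bool) → List A → ℕ
  countL P xs = sum (map (λ v → if P v then 1 else 0) xs)

  countL-++ : {A : Set} (P : A → Bool) (xs ys : List A) → countL P (xs ++ ys) ≡ countL P xs + countL P ys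
  countL-++ P xs ys = trans (cong sum (map-++ _ xs ys)) (sum-++ (map _ xs) (map _ ys))

  countL-map : {A B : Set} (P : B → Bool) (f : A → B) (xs : List A) → countL P (map f xs) ≡ countL (λ a → P (f a)) xs
  countL-map P f xs = cong sum (sym (map-∘ xs))

  countL-cong : {A : Set} {P Q : A → Bool} → (∀ x → P x ≡ Q x) → (xs : List A) → countL P xs ≡ countL Q xs
  countL-cong P≗Q [] = refl
  countL-cong P≗Q (x ∷ xs) rewrite P≗Q x = cong (_ +_) (countL-cong P≗Q xs)

  countL-split : {A : Set} (P Q : A → Bool) (xs : List A) →
    countL P xs ≡ countL (λ x → P x ∧ Q x) xs + countL (λ x → P x ∧ not (Q x)) xs
  countL-split P Q [] = refl
  countL-split P Q (x ∷ xs) with P x | Q x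
  ... | false | _ = countL-split P Q xs
  ... | true | true = cong suc (countL-split P Q xs)
  ... | true | false = trans (cong suc (countL-split P Q xs)) (sym (+-suc _ _))

  countL-mono : {A : Set} {P Q : A → Bool} → (∀ x → P x ≡ true → Q x ≡ true) → (xs : List A) →
    countL P xs ≤ countL Q xs
  countL-mono P⊆Q [] = z≤n
  countL-mono {P = P} {Q} P⊆Q (x ∷ xs) with P x in p | Q x in q
  ... | false | false = countL-mono P⊆Q xs
  ... | false | true = ≤-trans (countL-mono P⊆Q xs) (n≤1+n _)
  ... | true | true = s≤s (countL-mono P⊆Q xs)
  ... | true | false with () ← trans (sym q) (P⊆Q x p)

abstract
  count : Pred n → ℕ
  count {n} P = countL P (allVecs n)

  card≡count : (U : Subspace n) → card U ≡ count (mem U)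
  card≡count U = refl

  count-cong : {P Q : Pred n} → (∀ x → P x ≡ Q x) → count P ≡ count Q
  count-cong {n} P≗Q = countL-cong P≗Q (allVecs n)

  count-split : (P Q : Pred n) → count P ≡ count (P ∩ᵖ Q) + count (P ∖ᵖ Q)
  count-split {n} P Q = countL-split P Q (allVecs n)

  count-mono : {P Q : Pred n} → P ⊆ᵖ Q → count P ≤ count Q
  count-mono {n} P⊆Q = countL-mono P⊆Q (allVecs n)

  count-suc : (P : Pred (suc n)) → count P ≡ count (λ v → P (false ∷ v)) + count (λ v → P (true ∷ v))
  count-suc {n} P = trans (countL-++ P (map (false ∷_) (allVecs n)) (map (true ∷_) (allVecs n)))
    (cong₂ _+_ (countL-map P (false ∷_) (allVecs n)) (countL-map P (true ∷_) (allVecs n)))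

  count-witness : (P : Pred n) → 1 ≤ count P → Σ (V n) λ v → P v ≡ true
  count-witness {zero} P h with P [] in p
  ... | true = [] , p
  ... | false with () ← h
  count-witness {suc n} P h with count (λ v → P (false ∷ v)) in c
  ... | suc _ = let v , p = count-witness (λ v → P (false ∷ v)) (subst (1 ≤_) (sym c) (s≤s z≤n)) in (false ∷ v) , p
  ... | zero = let v , p = count-witness (λ v → P (true ∷ v)) (subst (1 ≤_) (trans (count-suc P) (cong (_+ count (λ v → P (true ∷ v))) c)) h)
               in (true ∷ v) , p

  count-pos : (P : Pred n) (x : V n) → P x ≡ true → 1 ≤ count P
  count-pos {zero} P [] Px rewrite Px = s≤s z≤n
  count-pos {suc n} P (false ∷ x) Px rewrite count-suc P = ≤-trans (count-pos (λ v → P (false ∷ v)) x Px) (m≤m+n _ _)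
  count-pos {suc n} P (true ∷ x) Px rewrite count-suc P = ≤-trans (count-pos (λ v → P (true ∷ v)) x Px) (m≤n+m _ _)

  count-translate : (P : Pred n) (a : V n) → count (λ x → P (x ⊕ a)) ≡ count P
  count-translate {zero} P [] = refl
  count-translate {suc n} P (false ∷ a) =
    trans (count-suc (λ x → P (x ⊕ (false ∷ a))))
      (trans (cong₂ _+_ (count-translate (λ v → P (false ∷ v)) a) (count-translate (λ v → P (true ∷ v)) a))
        (sym (count-suc P)))
  count-translate {suc n} P (true ∷ a) =
    trans (count-suc (λ x → P (x ⊕ (true ∷ a))))
      (trans (cong₂ _+_ (count-translate (λ v → P (true ∷ v)) a) (count-translate (λ v → P (false ∷ v)) a))
        (trans (+-comm (count (λ v → P (true ∷ v))) _) (sym (count-suc P))))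

  count-all : ∀ n → count {n} (λ _ → true) ≡ 2 ^ n
  count-all zero = refl
  count-all (suc n) = trans (count-suc {n} (λ _ → true))
    (cong₂ _+_ (count-all n) (trans (count-all n) (sym (+-identityʳ _))))

  count-none : ∀ n → count {n} (λ _ → false) ≡ 0
  count-none zero = refl
  count-none (suc n) = trans (count-suc {n} (λ _ → false)) (cong₂ _+_ (count-none n) (count-none n))

  count-isZero : ∀ n → count {n} isZero ≡ 1
  count-isZero zero = refl
  count-isZero (suc n) = trans (count-suc {n} isZero) (cong₂ _+_ (count-isZero n) (count-none n))

count≡0⇒∉ : (P : Pred n) → count P ≡ 0 → ¬ P x ≡ true
count≡0⇒∉ P c≡0 Px with () ← subst (1 ≤_) c≡0 (count-pos P _ Px)

count-∖ : (P Q : Pred n) {k l : ℕ} → count P ≡ k + l → count (P ∩ᵖ Q) ≡ k → count (P ∖ᵖ Q) ≡ l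
count-∖ P Q {k} P≡k+l P∩Q≡k = +-cancelˡ-≡ k _ _ (trans (sym (trans (count-split P Q) (cong (_+ _) P∩Q≡k))) P≡k+l)

⊆ᵖ-or-witness : (P Q : Pred n) → P ⊆ᵖ Q ⊎ Σ (V n) λ v → P v ≡ true × ¬ Q v ≡ true
⊆ᵖ-or-witness P Q with count (P ∖ᵖ Q) in c
... | zero = inj₁ λ x Px → decide x Px (Q x ≟ᵇ true)
  where
  decide : ∀ x → P x ≡ true → Dec (Q x ≡ true) → Q x ≡ true
  decide x Px (yes Qx) = Qx
  decide x Px (no ¬Qx) = ⊥-elim (count≡0⇒∉ (P ∖ᵖ Q) c (∧-true⁺ Px (not-true⁺ ¬Qx)))
... | suc _ = let v , v∈P∖Q = count-witness (P ∖ᵖ Q) (subst (1 ≤_) (sym c) (s≤s z≤n))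
              in inj₂ (v , ∧-true⁻ˡ v∈P∖Q , not-true⁻ (∧-true⁻ʳ v∈P∖Q))

count-cong-⇔ : {P Q : Pred n} → P ⊆ᵖ Q → Q ⊆ᵖ P → count P ≡ count Q
count-cong-⇔ P⊆Q Q⊆P = count-cong λ x → true-⇔⇒≡ (P⊆Q x) (Q⊆P x)

⊆ᵖ-by-count-∩ : (P Q : Pred n) → count P ≤ count (P ∩ᵖ Q) → P ⊆ᵖ Q
⊆ᵖ-by-count-∩ P Q |P|≤|P∩Q| x Px with Q x ≟ᵇ true
... | yes Qx = Qx
... | no ¬Qx = ⊥-elim (count≡0⇒∉ (P ∖ᵖ Q) P∖Q≡0 (∧-true⁺ Px (not-true⁺ ¬Qx)))
  where
  P∖Q≡0 : count (P ∖ᵖ Q) ≡ 0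
  P∖Q≡0 = n≤0⇒n≡0 (+-cancelˡ-≤ (count (P ∩ᵖ Q)) _ _
    (subst₂ _≤_ (count-split P Q) (sym (+-identityʳ _)) |P|≤|P∩Q|))

⊆-by-count : {P Q : Pred n} → P ⊆ᵖ Q → count Q ≤ count P → Q ⊆ᵖ P
⊆-by-count {P = P} {Q} P⊆Q |Q|≤|P| =
  ⊆ᵖ-by-count-∩ Q P (subst (count Q ≤_) (count-cong-⇔ (λ x Px → ∧-true⁺ (P⊆Q x Px) Px) (λ x → ∧-true⁻ʳ)) |Q|≤|P|)

count-∨-disjoint : {P Q : Pred n} → (∀ x → P x ≡ true → ¬ Q x ≡ true) → count (λ x → P x ∨ Q x) ≡ count P + count Q
count-∨-disjoint {P = P} {Q} disjoint =
  trans (count-split (λ x → P x ∨ Q x) P) (cong₂ _+_ (count-cong on-P) (count-cong on-Q))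
  where
  on-P : ∀ x → ((P x ∨ Q x) ∧ P x) ≡ P x
  on-P x = true-⇔⇒≡ ∧-true⁻ʳ (λ Px → ∧-true⁺ (∨-true⁺ˡ Px) Px)
  on-Q : ∀ x → ((P x ∨ Q x) ∧ not (P x)) ≡ Q x
  on-Q x = true-⇔⇒≡ only-Q (λ Qx → ∧-true⁺ (∨-true⁺ʳ Qx) (not-true⁺ λ Px → disjoint x Px Qx))
    where
    only-Q : ((P x ∨ Q x) ∧ not (P x)) ≡ true → Q x ≡ true
    only-Q h with ∨-true⁻ (∧-true⁻ˡ {a = P x ∨ Q x} h)
    ... | inj₁ Px = ⊥-elim (not-true⁻ (∧-true⁻ʳ {a = P x ∨ Q x} h) Px)
    ... | inj₂ Qx = Qx

nonzero-witness : (P : Pred n) → 2 ≤ count P → Σ (V n) λ v → P v ≡ true × v ≢ 0v n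
nonzero-witness {n} P 2≤|P| =
  let v , v∈ = count-witness (P ∖ᵖ isZero) 1≤|P∖0|
  in v , ∧-true⁻ˡ v∈ , λ v≡0 → not-true⁻ (∧-true⁻ʳ v∈) (subst (λ w → isZero w ≡ true) (sym v≡0) (isZero-0v n))
  where
  |P∩0|≤1 : count (P ∩ᵖ isZero) ≤ 1
  |P∩0|≤1 = subst (count (P ∩ᵖ isZero) ≤_) (count-isZero n) (count-mono λ _ → ∧-true⁻ʳ)
  1≤|P∖0| : 1 ≤ count (P ∖ᵖ isZero)
  1≤|P∖0| = +-cancelˡ-≤ 1 _ _ (≤-trans 2≤|P| (subst (_≤ 1 + count (P ∖ᵖ isZero)) (sym (count-split P isZero))
              (+-monoˡ-≤ _ |P∩0|≤1)))

⊈-witness : (U W : Subspace n) → ¬ U ⊆ W → Σ (V n) λ v → v ∈ U × v ∉ W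
⊈-witness U W U⊈W with ⊆ᵖ-or-witness (mem U) (mem W)
... | inj₁ U⊆W = ⊥-elim (U⊈W U⊆W)
... | inj₂ w = w

count-+⟨⟩ : (X : Subspace n) (c : V n) → c ∉ X → count (mem (X +⟨ c ⟩)) ≡ 2 * count (mem X)
count-+⟨⟩ X c c∉X = begin
  count (mem (X +⟨ c ⟩))                  ≡⟨ count-∨-disjoint (λ v v∈X v⊕c∈X → c∉X (∈-⊕⁻ʳ X v∈X v⊕c∈X)) ⟩
  count (mem X) + count (λ v → mem X (v ⊕ c)) ≡⟨ cong (count (mem X) +_) (count-translate (mem X) c) ⟩
  count (mem X) + count (mem X)           ≡⟨ cong (count (mem X) +_) (sym (+-identityʳ _)) ⟩
  2 * count (mem X)                       ∎
  where open ≡-Reasoning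

module IndexTwo (X Y : Subspace n) (X⊆Y : X ⊆ Y) (|Y|≤2|X| : count (mem Y) ≤ 2 * count (mem X)) where

  ⊕-∈ : x ∈ Y → x ∉ X → y ∈ Y → y ∉ X → (x ⊕ y) ∈ X
  ⊕-∈ {x} {y} x∈Y x∉X y∈Y y∉X with ∈-+⟨⟩⁻ X x (Y⊆X+x y y∈Y)
    where
    X+x⊆Y : X +⟨ x ⟩ ⊆ Y
    X+x⊆Y v v∈ with ∈-+⟨⟩⁻ X x v∈
    ... | inj₁ v∈X = X⊆Y v v∈X
    ... | inj₂ v⊕x∈X = ∈-⊕⁻ˡ Y x∈Y (X⊆Y _ v⊕x∈X)
    Y⊆X+x : Y ⊆ X +⟨ x ⟩
    Y⊆X+x = ⊆-by-count X+x⊆Y (subst (count (mem Y) ≤_) (sym (count-+⟨⟩ X x x∉X)) |Y|≤2|X|)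
  ... | inj₁ y∈X = ⊥-elim (y∉X y∈X)
  ... | inj₂ y⊕x∈X = ∈-resp-≡ X (⊕-comm y x) y⊕x∈X

  ∩-count : (Z : Subspace n) → Z ⊆ Y → x ∈ Z → x ∉ X → count (mem Z) ≡ 2 * count (mem (Z ∩ X))
  ∩-count {x = z} Z Z⊆Y z∈Z z∉X = begin
    count (mem Z)                                       ≡⟨ count-split (mem Z) (mem X) ⟩
    count (mem (Z ∩ X)) + count (mem Z ∖ᵖ mem X)        ≡⟨ cong (count (mem (Z ∩ X)) +_) Z∖X≡Z∩X ⟩
    count (mem (Z ∩ X)) + count (mem (Z ∩ X))           ≡⟨ cong (count (mem (Z ∩ X)) +_) (sym (+-identityʳ _)) ⟩
    2 * count (mem (Z ∩ X))                             ∎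
    where
    open ≡-Reasoning
    translate : ∀ w → (mem Z ∖ᵖ mem X) (w ⊕ z) ≡ mem (Z ∩ X) w
    translate w = true-⇔⇒≡
      (λ h → ∈-∩⁺ Z X (∈-⊕⁻ˡ Z z∈Z (∧-true⁻ˡ h))
        (∈-resp-≡ X (⊕-cancelʳ z w) (⊕-∈ (Z⊆Y _ (∧-true⁻ˡ h)) (not-true⁻ (∧-true⁻ʳ h)) (Z⊆Y z z∈Z) z∉X)))
      (λ h → ∧-true⁺ (∈-⊕ Z (∈-∩⁻ˡ Z X h) z∈Z) (not-true⁺ (∉-⊕ X z∉X (∈-∩⁻ʳ Z X h) ∘ ∈-resp-≡ X (⊕-comm w z))))
    Z∖X≡Z∩X : count (mem Z ∖ᵖ mem X) ≡ count (mem (Z ∩ X))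
    Z∖X≡Z∩X = trans (sym (count-translate _ z)) (count-cong translate)

  ∩-count-≤ : (Z : Subspace n) → Z ⊆ Y → count (mem Z) ≤ 2 * count (mem (Z ∩ X))
  ∩-count-≤ Z Z⊆Y with ⊆ᵖ-or-witness (mem Z) (mem X)
  ... | inj₂ (z , z∈Z , z∉X) = ≤-reflexive (∩-count Z Z⊆Y z∈Z z∉X)
  ... | inj₁ Z⊆X = ≤-trans
    (≤-reflexive (count-cong {Q = mem (Z ∩ X)} λ w → true-⇔⇒≡ (λ w∈ → ∧-true⁺ w∈ (Z⊆X w w∈)) ∧-true⁻ˡ))
                    (m≤m+n _ _)

∃-or-∀ : {P Q : Fin n → Set} → (∀ i → P i ⊎ Q i) → Σ (Fin n) P ⊎ (∀ i → Q i)
∃-or-∀ {zero} _ = inj₂ λ ()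
∃-or-∀ {suc n} P⊎Q with P⊎Q zero | ∃-or-∀ (P⊎Q ∘ suc)
... | inj₁ p | _ = inj₁ (zero , p)
... | inj₂ _ | inj₁ (i , p) = inj₁ (suc i , p)
... | inj₂ q | inj₂ qs = inj₂ λ { zero → q ; (suc i) → qs i }

∀-by-excluding : {P : Fin n → Set} (a b c : Fin n) → P a → P b → P c →
  (∀ i → i ≢ a → i ≢ b → i ≢ c → P i) → ∀ i → P i
∀-by-excluding a b c Pa Pb Pc rest i with i ≟ᶠ a | i ≟ᶠ b | i ≟ᶠ c
... | yes refl | _ | _ = Pa
... | no _ | yes refl | _ = Pb
... | no _ | no _ | yes refl = Pc
... | no i≢a | no i≢b | no i≢c = rest i i≢a i≢b i≢c

pair : Fin n → Fin n → Fin n → Bool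
pair a b i = does (i ≟ᶠ a) ∨ does (i ≟ᶠ b)

size-pair : (a b : Fin 6) → a ≢ b → size (pair a b) ≡ 2
size-pair = from-yes (all? λ (a : Fin 6) → all? λ (b : Fin 6) → ¬? (a ≟ᶠ b) →-dec (size (pair a b) ≟ 2))

fourth-unique : (a b c x y : Fin 4) → a ≢ b → a ≢ c → b ≢ c →
  x ≢ a → x ≢ b → x ≢ c → y ≢ a → y ≢ b → y ≢ c → x ≡ y
fourth-unique = from-yes
  (all? λ (a : Fin 4) → all? λ (b : Fin 4) → all? λ (c : Fin 4) → all? λ (x : Fin 4) → all? λ (y : Fin 4) →
    ¬? (a ≟ᶠ b) →-dec (¬? (a ≟ᶠ c) →-dec (¬? (b ≟ᶠ c) →-dec
    (¬? (x ≟ᶠ a) →-dec (¬? (x ≟ᶠ b) →-dec (¬? (x ≟ᶠ c) →-dec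
    (¬? (y ≟ᶠ a) →-dec (¬? (y ≟ᶠ b) →-dec (¬? (y ≟ᶠ c) →-dec (x ≟ᶠ y))))))))))

-- A Bool s names one of the two members U₀, U₁ of dimension n − 2 and
-- not s the other one; small i is the i-th member of dimension n − 3.
big : Bool → Fin 6
big false = zero
big true = suc zero

small : Fin 4 → Fin 6
small i = suc (suc i)

small-injective : ∀ {i j} → small i ≡ small j → i ≡ j
small-injective refl = refl

big≢small : ∀ s i → big s ≢ small i
big≢small false i ()
big≢small true i ()

big-injective : ∀ s → big s ≢ big (not s)
big-injective false ()
big-injective true ()

∀-by-parts : {P : Fin 6 → Set} (s : Bool) → P (big s) → P (big (not s)) → (∀ i → P (small i)) → ∀ m → P m
∀-by-parts false on-big on-other on-small zero = on-big
∀-by-parts false on-big on-other on-small (suc zero) = on-other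
∀-by-parts true on-big on-other on-small zero = on-other
∀-by-parts true on-big on-other on-small (suc zero) = on-big
∀-by-parts s on-big on-other on-small (suc (suc i)) = on-small i

classify : ∀ s j → j ≡ big s ⊎ j ≡ big (not s) ⊎ Σ (Fin 4) λ i → j ≡ small i
classify false zero = inj₁ refl
classify false (suc zero) = inj₂ (inj₁ refl)
classify true zero = inj₂ (inj₁ refl)
classify true (suc zero) = inj₁ refl
classify s (suc (suc i)) = inj₂ (inj₂ (i , refl))

-- A hypothetical counterexample, with n = 6 + k

module Counterexample
  (k : ℕ) (H : Subspace (6 + k)) (U : Fin 6 → Subspace (6 + k))
  (|H| : count (mem H) ≡ 2 ^ (5 + k))
  (U⊈H : ∀ i → ¬ U i ⊆ H)
  (partition : ∀ v → IsPoint v → v ∈ full → v ∉ H → ExactlyOne allS U v)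
  (|U| : ∀ s → count (mem (U (big s))) ≡ 2 ^ (4 + k))
  (|S| : ∀ i → count (mem (U (small i))) ≡ 2 ^ (3 + k))
  (tight : Tight U)
  (irreducible : Irreducible H U)
  where

  Vₙ : Set
  Vₙ = V (6 + k)

  -- pow i is the size of a subspace of codimension 6 − i.
  pow : ℕ → ℕ
  pow i = 2 ^ (i + k)

  S : Fin 4 → Subspace (6 + k)
  S i = U (small i)

  ∉H⇒point : x ∉ H → IsPoint x
  ∉H⇒point x∉H x≡0 = x∉H (∈-resp-≡ H (sym x≡0) (hasZero H))

  ∈-some : x ∉ H → Σ (Fin 6) λ i → x ∈ U i
  ∈-some {x} x∉H = let (i , _ , x∈Uᵢ) , _ = partition x (∉H⇒point x∉H) refl x∉H in i , x∈Uᵢ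

  unique : x ∉ H → ∀ {i j} → x ∈ U i → x ∈ U j → i ≡ j
  unique {x} x∉H x∈Uᵢ x∈Uⱼ = proj₂ (partition x (∉H⇒point x∉H) refl x∉H) _ _ refl refl x∈Uᵢ x∈Uⱼ

  unique-small : ∀ {i j} → x ∉ H → x ∈ S i → x ∈ S j → i ≡ j
  unique-small x∉H x∈Sᵢ x∈Sⱼ = small-injective (unique x∉H x∈Sᵢ x∈Sⱼ)

  affine-point : ∀ i → Σ Vₙ λ v → v ∈ U i × v ∉ H
  affine-point i = ⊈-witness (U i) H (U⊈H i)

  module H-index = IndexTwo H full (λ _ _ → refl)
    (≤-reflexive (trans (count-all (6 + k)) (cong (2 *_) (sym |H|))))

  ⊕-∈H : x ∉ H → y ∉ H → (x ⊕ y) ∈ H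
  ⊕-∈H x∉H y∉H = H-index.⊕-∈ refl x∉H refl y∉H

  D : Bool → Subspace (6 + k)
  D s = U (big s) ∩ H

  E : Fin 4 → Subspace (6 + k)
  E i = S i ∩ H

  half-in-H : ∀ j → count (mem (U j)) ≡ 2 * count (mem (U j ∩ H))
  half-in-H j = let v , v∈ , v∉H = affine-point j in H-index.∩-count (U j) (λ _ _ → refl) v∈ v∉H

  |D| : ∀ s → count (mem (D s)) ≡ pow 3
  |D| s = *-cancelˡ-≡ _ _ 2 (trans (sym (half-in-H (big s))) (|U| s))

  |E| : ∀ i → count (mem (E i)) ≡ pow 2
  |E| i = *-cancelˡ-≡ _ _ 2 (trans (sym (half-in-H (small i))) (|S| i))

  ⊆-by-affine-part : (W Z : Subspace (6 + k)) → (∀ u → u ∈ Z → u ∉ H → u ∈ W) → x ∈ Z → x ∉ H → Z ⊆ W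
  ⊆-by-affine-part W Z affine⊆W x∈Z x∉H u u∈Z with mem H u ≟ᵇ true
  ... | no u∉H = affine⊆W u u∈Z u∉H
  ... | yes u∈H = ∈-⊕⁻ʳ W (affine⊆W _ x∈Z x∉H) (affine⊆W _ (∈-⊕ Z x∈Z u∈Z) (∉-⊕ H x∉H u∈H))

  -- Two members covering the affine part of a proper subspace W form an
  -- avsp of W, which irreducibility forbids.
  no-pair-partition : (W : Subspace (6 + k)) (d : ℕ) → count (mem W) ≡ 2 ^ d → d < 6 + k →
    ∀ {a b} → a ≢ b → x ∈ W → x ∉ H → U a ⊆ W → U b ⊆ W →
    (∀ v → v ∈ W → v ∉ H → v ∈ U a ⊎ v ∈ U b) → ⊥
  no-pair-partition W d |W| d<n {a} {b} a≢b x∈W x∉H Uₐ⊆W U_b⊆W covers =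
    irreducible (W , pair a b , (d , trans (card≡count W) |W| , d<n) ,
      subst (1 <_) (sym 2≡) (s≤s (s≤s z≤n)) , subst (_< 6) (sym 2≡) (s≤s (s≤s (s≤s z≤n))) ,
      (λ W⊆H → x∉H (W⊆H _ x∈W)) , members , partitions)
    where
    2≡ : size (pair a b) ≡ 2
    2≡ = size-pair a b a≢b
    members : ∀ i → pair a b i ≡ true → (U i ⊆ W) × ¬ U i ⊆ H
    members i i∈ with i ≟ᶠ a | i ≟ᶠ b
    ... | yes refl | _ = Uₐ⊆W , U⊈H a
    ... | no _ | yes refl = U_b⊆W , U⊈H b
    ... | no _ | no _ with () ← i∈
    a∈ : pair a b a ≡ true
    a∈ = ∨-true⁺ˡ (dec-true (a ≟ᶠ a) refl)
    b∈ : pair a b b ≡ true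
    b∈ = ∨-true⁺ʳ (dec-true (b ≟ᶠ b) refl)
    partitions : ∀ v → IsPoint v → v ∈ W → v ∉ H → ExactlyOne (pair a b) U v
    partitions v _ v∈W v∉H with covers v v∈W v∉H
    ... | inj₁ v∈Uₐ = (a , a∈ , v∈Uₐ) , λ _ _ _ _ → unique v∉H
    ... | inj₂ v∈U_b = (b , b∈ , v∈U_b) , λ _ _ _ _ → unique v∉H

  traces-differ : ¬ D true ⊆ D false
  traces-differ D₁⊆D₀ =
    no-pair-partition W (5 + k) |W| ≤-refl (big-injective false) (∈-+⟨self⟩ U₀ q) q∉H
      (λ x → ∈-+⟨⟩⁺ˡ U₀ q) U₁⊆W covers
    where
    U₀ U₁ : Subspace (6 + k)
    U₀ = U (big false)
    U₁ = U (big true)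
    q : Vₙ
    q = proj₁ (affine-point (big true))
    q∈U₁ : q ∈ U₁
    q∈U₁ = proj₁ (proj₂ (affine-point (big true)))
    q∉H : q ∉ H
    q∉H = proj₂ (proj₂ (affine-point (big true)))
    D₀⊆D₁ : D false ⊆ D true
    D₀⊆D₁ = ⊆-by-count D₁⊆D₀ (≤-reflexive (trans (|D| false) (sym (|D| true))))
    W : Subspace (6 + k)
    W = U₀ +⟨ q ⟩
    |W| : count (mem W) ≡ 2 ^ (5 + k)
    |W| = trans (count-+⟨⟩ U₀ q (λ q∈U₀ → big-injective false (unique q∉H q∈U₀ q∈U₁))) (cong (2 *_) (|U| false))
    U₁⊆W : U₁ ⊆ W
    U₁⊆W x x∈U₁ with mem H x ≟ᵇ true
    ... | yes x∈H = ∈-+⟨⟩⁺ˡ U₀ q (∈-∩⁻ˡ U₀ H (D₁⊆D₀ x (∈-∩⁺ U₁ H x∈U₁ x∈H)))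
    ... | no x∉H = ∈-+⟨⟩⁺ʳ U₀ q (∈-∩⁻ˡ U₀ H (D₁⊆D₀ _ (∈-∩⁺ U₁ H (∈-⊕ U₁ x∈U₁ q∈U₁) (⊕-∈H x∉H q∉H))))
    covers : ∀ v → v ∈ W → v ∉ H → v ∈ U₀ ⊎ v ∈ U₁
    covers v v∈W v∉H with ∈-+⟨⟩⁻ U₀ q v∈W
    ... | inj₁ v∈U₀ = inj₁ v∈U₀
    ... | inj₂ v⊕q∈U₀ = inj₂ (∈-⊕⁻ˡ U₁ q∈U₁ (∈-∩⁻ˡ U₁ H (D₀⊆D₁ _ (∈-∩⁺ U₀ H v⊕q∈U₀ (⊕-∈H v∉H q∉H)))))

  affine : Subspace (6 + k) → Pred (6 + k)
  affine W = mem W ∖ᵖ mem H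

  |affine-S| : ∀ i → count (affine (S i)) ≡ pow 2
  |affine-S| i = count-∖ (mem (S i)) (mem H) (trans (|S| i) (cong (pow 2 +_) (+-identityʳ _))) (|E| i)

  module DistinctTraces (d : Vₙ) (d∈D₁ : d ∈ D true) (d∉D₀ : d ∉ D false)
                        (e : Vₙ) (e∈D₀ : e ∈ D false) (e∉D₁ : e ∉ D true) where

    K : Subspace (6 + k)
    K = D false +⟨ d ⟩

    K⊆H : K ⊆ H
    K⊆H x x∈K with ∈-+⟨⟩⁻ (D false) d x∈K
    ... | inj₁ x∈D₀ = ∈-∩⁻ʳ (U (big false)) H x∈D₀
    ... | inj₂ x⊕d∈D₀ = ∈-⊕⁻ˡ H (∈-∩⁻ʳ (U (big true)) H d∈D₁) (∈-∩⁻ʳ (U (big false)) H x⊕d∈D₀)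

    |K| : count (mem K) ≡ pow 4
    |K| = trans (count-+⟨⟩ (D false) d d∉D₀) (cong (2 *_) (|D| false))

    module K-index = IndexTwo K H K⊆H (≤-reflexive (trans |H| (cong (2 *_) (sym |K|))))

    apex : Bool → Vₙ
    apex s = proj₁ (affine-point (big s))

    apex∈U : ∀ s → apex s ∈ U (big s)
    apex∈U s = proj₁ (proj₂ (affine-point (big s)))

    apex∉H : ∀ s → apex s ∉ H
    apex∉H s = proj₂ (proj₂ (affine-point (big s)))

    r : Vₙ
    r = apex false ⊕ apex true

    ⊕r∉U₀ : y ∈ D true → (y ⊕ r) ∉ U (big false)
    ⊕r∉U₀ {y} y∈D₁ y⊕r∈U₀ = big-injective false (unique y⊕q∉H y⊕q∈U₀ y⊕q∈U₁)
      where
      y⊕q∈U₀ : (y ⊕ apex true) ∈ U (big false)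
      y⊕q∈U₀ = ∈-resp-≡ (U (big false))
        (solve (v₀ ⊞ (v₁ ⊞ (v₀ ⊞ v₂))) (v₁ ⊞ v₂) refl (apex false ∷ y ∷ apex true ∷ []))
                 (∈-⊕ (U (big false)) (apex∈U false) y⊕r∈U₀)
      y⊕q∈U₁ : (y ⊕ apex true) ∈ U (big true)
      y⊕q∈U₁ = ∈-⊕ (U (big true)) (∈-∩⁻ˡ (U (big true)) H y∈D₁) (apex∈U true)
      y⊕q∉H : (y ⊕ apex true) ∉ H
      y⊕q∉H y⊕q∈H = apex∉H true (∈-⊕⁻ʳ H (∈-∩⁻ʳ (U (big true)) H y∈D₁) y⊕q∈H)

    r∉K : r ∉ K
    r∉K r∈K with ∈-+⟨⟩⁻ (D false) d r∈K
    ... | inj₁ r∈D₀ = ⊕r∉U₀ (hasZero (D true))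
      (∈-resp-≡ (U (big false)) (sym (⊕-identityˡ r)) (∈-∩⁻ˡ (U (big false)) H r∈D₀))
    ... | inj₂ r⊕d∈D₀ = ⊕r∉U₀ d∈D₁ (∈-resp-≡ (U (big false)) (⊕-comm r d) (∈-∩⁻ˡ (U (big false)) H r⊕d∈D₀))

    H⊆K+r : H ⊆ K +⟨ r ⟩
    H⊆K+r = ⊆-by-count K+r⊆H (≤-reflexive (trans |H| (sym (trans (count-+⟨⟩ K r r∉K) (cong (2 *_) |K|)))))
      where
      K+r⊆H : K +⟨ r ⟩ ⊆ H
      K+r⊆H x x∈ with ∈-+⟨⟩⁻ K r x∈
      ... | inj₁ x∈K = K⊆H x x∈K
      ... | inj₂ x⊕r∈K = ∈-⊕⁻ˡ H (⊕-∈H (apex∉H false) (apex∉H true)) (K⊆H _ x⊕r∈K)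

    D⊆K : ∀ s → D s ⊆ K
    D⊆K false x x∈D₀ = ∈-+⟨⟩⁺ˡ (D false) d x∈D₀
    D⊆K true x x∈D₁ with ∈-+⟨⟩⁻ K r (H⊆K+r x (∈-∩⁻ʳ (U (big true)) H x∈D₁))
    ... | inj₁ x∈K = x∈K
    ... | inj₂ x⊕r∈K with ∈-+⟨⟩⁻ (D false) d x⊕r∈K
    ... | inj₁ x⊕r∈D₀ = ⊥-elim (⊕r∉U₀ x∈D₁ (∈-∩⁻ˡ (U (big false)) H x⊕r∈D₀))
    ... | inj₂ x⊕r⊕d∈D₀ = ⊥-elim (⊕r∉U₀ (∈-⊕ (D true) x∈D₁ d∈D₁)
            (∈-resp-≡ (U (big false)) (solve ((v₀ ⊞ v₁) ⊞ v₂) ((v₀ ⊞ v₂) ⊞ v₁) refl (x ∷ r ∷ d ∷ []))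
              (∈-∩⁻ˡ (U (big false)) H x⊕r⊕d∈D₀)))

    shift : Bool → Vₙ
    shift false = d
    shift true = e

    shift∈K : ∀ s → shift s ∈ K
    shift∈K false = ∈-+⟨self⟩ (D false) d
    shift∈K true = D⊆K false e e∈D₀

    shift∉U : ∀ s → shift s ∉ U (big s)
    shift∉U false d∈U₀ = d∉D₀ (∈-∩⁺ (U (big false)) H d∈U₀ (K⊆H d (shift∈K false)))
    shift∉U true e∈U₁ = e∉D₁ (∈-∩⁺ (U (big true)) H e∈U₁ (K⊆H e (shift∈K true)))

    K⊆D+shift : ∀ s → K ⊆ D s +⟨ shift s ⟩
    K⊆D+shift false x x∈K = x∈K
    K⊆D+shift true = ⊆-by-count D₁+e⊆K
        (≤-reflexive (trans |K| (sym (trans (count-+⟨⟩ (D true) e e∉D₁) (cong (2 *_) (|D| true))))))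
      where
      D₁+e⊆K : D true +⟨ e ⟩ ⊆ K
      D₁+e⊆K x x∈ with ∈-+⟨⟩⁻ (D true) e x∈
      ... | inj₁ x∈D₁ = D⊆K true x x∈D₁
      ... | inj₂ x⊕e∈D₁ = ∈-⊕⁻ˡ K (shift∈K true) (D⊆K true _ x⊕e∈D₁)

    -- The affine points split into the two cosets apex s + K of the
    -- hyperplane K of H.
    coset : Bool → Pred (6 + k)
    coset s x = mem K (x ⊕ apex s)

    ⊕r-swaps-apex : ∀ s x → (x ⊕ apex s) ⊕ r ≡ x ⊕ apex (not s)
    ⊕r-swaps-apex false x = solve ((v₀ ⊞ v₁) ⊞ (v₁ ⊞ v₂)) (v₀ ⊞ v₂) refl (x ∷ apex false ∷ apex true ∷ [])
    ⊕r-swaps-apex true x = solve ((v₀ ⊞ v₂) ⊞ (v₁ ⊞ v₂)) (v₀ ⊞ v₁) refl (x ∷ apex false ∷ apex true ∷ [])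

    coset-cover : ∀ s → x ∉ H → coset s x ≡ true ⊎ coset (not s) x ≡ true
    coset-cover {x} s x∉H with ∈-+⟨⟩⁻ K r (H⊆K+r _ (⊕-∈H x∉H (apex∉H s)))
    ... | inj₁ in-s = inj₁ in-s
    ... | inj₂ in-not-s = inj₂ (∈-resp-≡ K (⊕r-swaps-apex s x) in-not-s)

    coset-disjoint : ∀ s → coset s x ≡ true → ¬ coset (not s) x ≡ true
    coset-disjoint {x} s in-s in-not-s =
      r∉K (∈-resp-≡ K (trans (cong ((x ⊕ apex s) ⊕_) (sym (⊕r-swaps-apex s x))) (⊕-cancelˡ _ r))
        (∈-⊕ K in-s in-not-s))

    coset-⊕K : ∀ s → coset s x ≡ true → y ∈ K → coset s (x ⊕ y) ≡ true
    coset-⊕K {x} {y} s in-s y∈K =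
      ∈-resp-≡ K (solve ((v₀ ⊞ v₂) ⊞ v₁) ((v₀ ⊞ v₁) ⊞ v₂) refl (x ∷ y ∷ apex s ∷ [])) (∈-⊕ K in-s y∈K)

    coset⇒∉H : ∀ s → coset s x ≡ true → x ∉ H
    coset⇒∉H s in-s x∈H = apex∉H s (∈-⊕⁻ʳ H x∈H (K⊆H _ in-s))

    big⇒coset : ∀ s → x ∈ U (big s) → x ∉ H → coset s x ≡ true
    big⇒coset s x∈U x∉H = D⊆K s _ (∈-∩⁺ (U (big s)) H (∈-⊕ (U (big s)) x∈U (apex∈U s)) (⊕-∈H x∉H (apex∉H s)))

    J : Subspace (6 + k)
    J = D true ∩ D false

    ∈-J : ∀ s → x ∈ U (big s) → x ∈ U (big (not s)) → x ∈ H → x ∈ J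
    ∈-J false x∈U₀ x∈U₁ x∈H = ∈-∩⁺ (D true) (D false) (∈-∩⁺ (U (big true)) H x∈U₁ x∈H)
      (∈-∩⁺ (U (big false)) H x∈U₀ x∈H)
    ∈-J true x∈U₁ x∈U₀ x∈H = ∈-∩⁺ (D true) (D false) (∈-∩⁺ (U (big true)) H x∈U₁ x∈H)
      (∈-∩⁺ (U (big false)) H x∈U₀ x∈H)

    J⊆D : ∀ s → J ⊆ D s
    J⊆D false x = ∈-∩⁻ʳ (D true) (D false)
    J⊆D true x = ∈-∩⁻ˡ (D true) (D false)

    J⊆U : ∀ s → J ⊆ U (big s)
    J⊆U s x x∈J = ∈-∩⁻ˡ (U (big s)) H (J⊆D s x x∈J)

    J⊆H : J ⊆ H
    J⊆H x x∈J = ∈-∩⁻ʳ (U (big false)) H (J⊆D false x x∈J)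

    J⊆K : J ⊆ K
    J⊆K x x∈J = D⊆K false x (J⊆D false x x∈J)

    |J| : count (mem J) ≡ pow 2
    |J| = *-cancelˡ-≡ _ _ 2 (trans (sym (D₀-index.∩-count (D true) (D⊆K true) d∈D₁ d∉D₀)) (|D| true))
      where
      module D₀-index = IndexTwo (D false) K (D⊆K false) (≤-reflexive (trans |K| (cong (2 *_) (sym (|D| false)))))

    G : Fin 4 → Subspace (6 + k)
    G i = E i ∩ K

    pow1≤|G| : ∀ i → pow 1 ≤ count (mem (G i))
    pow1≤|G| i = *-cancelˡ-≤ 2
      (subst (_≤ 2 * count (mem (G i))) (|E| i) (K-index.∩-count-≤ (E i) (λ x → ∈-∩⁻ʳ (S i) H)))

    module Side (s : Bool) where

      C : Pred (6 + k)
      C = coset s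

      B : Pred (6 + k)
      B = C ∖ᵖ mem (U (big s))

      b₀ : Vₙ
      b₀ = apex s ⊕ shift s

      B⁺ : C x ≡ true → x ∉ U (big s) → B x ≡ true
      B⁺ in-C x∉U = ∧-true⁺ in-C (not-true⁺ x∉U)

      B⇒C : B x ≡ true → C x ≡ true
      B⇒C = ∧-true⁻ˡ

      B⇒∉U : B x ≡ true → x ∉ U (big s)
      B⇒∉U {x} x∈B = not-true⁻ (∧-true⁻ʳ {C x} x∈B)

      B⇒∉H : B x ≡ true → x ∉ H
      B⇒∉H = coset⇒∉H s ∘ B⇒C

      B⇒b₀+D : B x ≡ true → (x ⊕ b₀) ∈ D s
      B⇒b₀+D {x} x∈B with ∈-+⟨⟩⁻ (D s) (shift s) (K⊆D+shift s _ (B⇒C x∈B))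
      ... | inj₁ x⊕a∈D = ⊥-elim (B⇒∉U x∈B (∈-⊕⁻ˡ (U (big s)) (apex∈U s) (∈-∩⁻ˡ (U (big s)) H x⊕a∈D)))
      ... | inj₂ x⊕a⊕t∈D = ∈-resp-≡ (D s) (⊕-assoc x (apex s) (shift s)) x⊕a⊕t∈D

      b₀+D⇒B : (x ⊕ b₀) ∈ D s → B x ≡ true
      b₀+D⇒B {x} x⊕b₀∈D = B⁺ in-C x∉U
        where
        in-C : C x ≡ true
        in-C = ∈-resp-≡ K (solve ((v₀ ⊞ (v₁ ⊞ v₂)) ⊞ v₂) (v₀ ⊞ v₁) refl (x ∷ apex s ∷ shift s ∷ []))
                 (∈-⊕ K (D⊆K s _ x⊕b₀∈D) (shift∈K s))
        x∉U : x ∉ U (big s)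
        x∉U x∈U = shift∉U s (∈-⊕⁻ʳ (U (big s)) (apex∈U s) (∈-⊕⁻ʳ (U (big s)) x∈U (∈-∩⁻ˡ (U (big s)) H x⊕b₀∈D)))

      B-⊕ : B x ≡ true → B y ≡ true → (x ⊕ y) ∈ D s
      B-⊕ {x} {y} x∈B y∈B = ∈-resp-≡ (D s) (solve ((v₀ ⊞ v₂) ⊞ (v₁ ⊞ v₂)) (v₀ ⊞ v₁) refl (x ∷ y ∷ b₀ ∷ []))
                              (∈-⊕ (D s) (B⇒b₀+D x∈B) (B⇒b₀+D y∈B))

      |B| : count B ≡ pow 3
      |B| = trans (count-cong-⇔ (λ x → B⇒b₀+D) (λ x → b₀+D⇒B)) (trans (count-translate (mem (D s)) b₀) (|D| s))

      S∩C⇒B : x ∈ S i → C x ≡ true → B x ≡ true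
      S∩C⇒B x∈S in-C = B⁺ in-C λ x∈U → big≢small s _ (unique (coset⇒∉H s in-C) x∈U x∈S)

      meets⇒G⊆U : x ∈ S i → C x ≡ true → G i ⊆ U (big s)
      meets⇒G⊆U {x} {i} x∈S x∈C g g∈G = ∈-resp-≡ (U (big s)) (⊕-cancelˡ x g)
        (∈-∩⁻ˡ (U (big s)) H (B-⊕ (S∩C⇒B x∈S x∈C) x⊕g∈B))
        where
        x⊕g∈B : B (x ⊕ g) ≡ true
        x⊕g∈B = S∩C⇒B (∈-⊕ (S i) x∈S (∈-∩⁻ˡ (S i) H (∈-∩⁻ˡ (E i) K g∈G))) (coset-⊕K s x∈C (∈-∩⁻ʳ (E i) K g∈G))

      B⇒S : B x ≡ true → Σ (Fin 4) λ i → x ∈ S i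
      B⇒S x∈B with ∈-some (B⇒∉H x∈B)
      ... | j , x∈Uⱼ with classify s j
      ... | inj₁ refl = ⊥-elim (B⇒∉U x∈B x∈Uⱼ)
      ... | inj₂ (inj₁ refl) = ⊥-elim (coset-disjoint s (B⇒C x∈B) (big⇒coset (not s) x∈Uⱼ (B⇒∉H x∈B)))
      ... | inj₂ (inj₂ (i , refl)) = i , x∈Uⱼ

      Contained : Fin 4 → Set
      Contained i = ∀ x → x ∈ S i → x ∉ H → C x ≡ true

      -- E i has index two in D s, and x ⊕ f, y ⊕ f lie in D s ∖ E i for f ∈ S i ∖ H.
      contained-⊕ : ∀ {i} → Contained i → B x ≡ true → B y ≡ true → x ∉ S i → y ∉ S i → (x ⊕ y) ∈ S i
      contained-⊕ {x} {y} {i} Sᵢ⊆C x∈B y∈B x∉Sᵢ y∉Sᵢ =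
        ∈-∩⁻ˡ (S i) H (∈-resp-≡ (E i) (solve ((v₀ ⊞ v₂) ⊞ (v₁ ⊞ v₂)) (v₀ ⊞ v₁) refl (x ∷ y ∷ f ∷ []))
          (E-index.⊕-∈ (B-⊕ x∈B f∈B) (outside x∈B x∉Sᵢ) (B-⊕ y∈B f∈B) (outside y∈B y∉Sᵢ)))
        where
        f : Vₙ
        f = proj₁ (affine-point (small i))
        f∈S : f ∈ S i
        f∈S = proj₁ (proj₂ (affine-point (small i)))
        f∈B : B f ≡ true
        f∈B = S∩C⇒B f∈S (Sᵢ⊆C f f∈S (proj₂ (proj₂ (affine-point (small i)))))
        E⊆D : E i ⊆ D s
        E⊆D z z∈E = ∈-∩⁺ (U (big s)) H
          (∈-resp-≡ (U (big s)) (⊕-cancelˡ f z) (∈-∩⁻ˡ (U (big s)) H (B-⊕ f∈B (S∩C⇒B f+z∈S (Sᵢ⊆C _ f+z∈S f+z∉H)))))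
          (∈-∩⁻ʳ (S i) H z∈E)
          where
          f+z∈S : (f ⊕ z) ∈ S i
          f+z∈S = ∈-⊕ (S i) f∈S (∈-∩⁻ˡ (S i) H z∈E)
          f+z∉H : (f ⊕ z) ∉ H
          f+z∉H = ∉-⊕ H (proj₂ (proj₂ (affine-point (small i)))) (∈-∩⁻ʳ (S i) H z∈E)
        module E-index = IndexTwo (E i) (D s) E⊆D (≤-reflexive (trans (|D| s) (cong (2 *_) (sym (|E| i)))))
        outside : ∀ {z} → B z ≡ true → z ∉ S i → (z ⊕ f) ∉ E i
        outside z∈B z∉Sᵢ z⊕f∈E = z∉Sᵢ (∈-⊕⁻ˡ (S i) f∈S (∈-∩⁻ˡ (S i) H z⊕f∈E))

      |S∩C| : y ∈ S i → C y ≡ true → count (mem (S i) ∩ᵖ C) ≡ count (mem (G i))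
      |S∩C| {y} {i} y∈S y∈C = trans (count-cong-⇔ {Q = λ x → mem (G i) (x ⊕ y)} to from)
        (count-translate (mem (G i)) y)
        where
        to : mem (S i) ∩ᵖ C ⊆ᵖ (λ x → mem (G i) (x ⊕ y))
        to x x∈ = ∈-∩⁺ (E i) K
          (∈-∩⁺ (S i) H (∈-⊕ (S i) (∧-true⁻ˡ x∈) y∈S)
            (⊕-∈H (coset⇒∉H s (∧-true⁻ʳ {mem (S i) x} x∈)) (coset⇒∉H s y∈C)))
          (∈-resp-≡ K (solve ((v₀ ⊞ v₂) ⊞ (v₁ ⊞ v₂)) (v₀ ⊞ v₁) refl (x ∷ y ∷ apex s ∷ []))
            (∈-⊕ K (∧-true⁻ʳ {mem (S i) x} x∈) y∈C))
        from : (λ x → mem (G i) (x ⊕ y)) ⊆ᵖ mem (S i) ∩ᵖ C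
        from x x⊕y∈G = ∧-true⁺ (∈-⊕⁻ˡ (S i) y∈S (∈-∩⁻ˡ (S i) H (∈-∩⁻ˡ (E i) K x⊕y∈G)))
          (∈-resp-≡ K (solve ((v₀ ⊞ v₁) ⊞ (v₁ ⊞ v₂)) (v₀ ⊞ v₂) refl (x ∷ y ∷ apex s ∷ []))
            (∈-⊕ K (∈-∩⁻ʳ (E i) K x⊕y∈G) y∈C))

      -- A point of S i in each coset gives a point of E i outside K.
      mixed⇒|G| : ∀ {i} → x ∈ S i → C x ≡ true → y ∈ S i → coset (not s) y ≡ true → count (mem (G i)) ≡ pow 1
      mixed⇒|G| {x} {y} {i} x∈S x∈C y∈S y∈C′ =
        *-cancelˡ-≡ _ _ 2 (trans (sym (K-index.∩-count (E i) (λ z → ∈-∩⁻ʳ (S i) H) x⊕y∈E x⊕y∉K)) (|E| i))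
        where
        x⊕y∈E : (x ⊕ y) ∈ E i
        x⊕y∈E = ∈-∩⁺ (S i) H (∈-⊕ (S i) x∈S y∈S) (⊕-∈H (coset⇒∉H s x∈C) (coset⇒∉H (not s) y∈C′))
        x⊕y∉K : (x ⊕ y) ∉ K
        x⊕y∉K x⊕y∈K = coset-disjoint s x∈C
          (∈-resp-≡ K (solve ((v₀ ⊞ v₁) ⊞ (v₁ ⊞ v₂)) (v₀ ⊞ v₂) refl (x ∷ y ∷ apex (not s) ∷ []))
                         (∈-⊕ K x⊕y∈K y∈C′))

    module ContainedCase (s : Bool) (i : Fin 4) (Sᵢ⊆C : Side.Contained s i) where
      open Side s
      module Side′ = Side (not s)

      |B∩Sᵢ| : count (B ∩ᵖ mem (S i)) ≡ pow 2
      |B∩Sᵢ| = trans (count-cong-⇔ to from) (|affine-S| i)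
        where
        to : B ∩ᵖ mem (S i) ⊆ᵖ affine (S i)
        to x x∈ = ∧-true⁺ (∧-true⁻ʳ {B x} x∈) (not-true⁺ (B⇒∉H (∧-true⁻ˡ x∈)))
        from : affine (S i) ⊆ᵖ B ∩ᵖ mem (S i)
        from x x∈ = let x∈S = ∧-true⁻ˡ x∈ in
          ∧-true⁺ (S∩C⇒B x∈S (Sᵢ⊆C x x∈S (not-true⁻ (∧-true⁻ʳ {mem (S i) x} x∈)))) x∈S

      |B∖Sᵢ| : count (B ∖ᵖ mem (S i)) ≡ pow 2
      |B∖Sᵢ| = count-∖ B (mem (S i)) (trans |B| (cong (pow 2 +_) (+-identityʳ _))) |B∩Sᵢ|

      y₀-witness : Σ Vₙ λ v → (B ∖ᵖ mem (S i)) v ≡ true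
      y₀-witness = count-witness (B ∖ᵖ mem (S i)) (subst (1 ≤_) (sym |B∖Sᵢ|) (m^n>0 2 (2 + k)))

      y₀ : Vₙ
      y₀ = proj₁ y₀-witness

      y₀∈B : B y₀ ≡ true
      y₀∈B = ∧-true⁻ˡ (proj₂ y₀-witness)

      y₀∉Sᵢ : y₀ ∉ S i
      y₀∉Sᵢ = not-true⁻ (∧-true⁻ʳ {B y₀} (proj₂ y₀-witness))

      j : Fin 4
      j = proj₁ (B⇒S y₀∈B)

      y₀∈Sⱼ : y₀ ∈ S j
      y₀∈Sⱼ = proj₂ (B⇒S y₀∈B)

      i≢j : i ≢ j
      i≢j i≡j = y₀∉Sᵢ (subst (λ m → y₀ ∈ S m) (sym i≡j) y₀∈Sⱼ)

      ∉S-of-other : ∀ {m m′} → m ≢ m′ → x ∉ H → x ∈ S m′ → x ∉ S m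
      ∉S-of-other m≢m′ x∉H x∈Sₘ′ x∈Sₘ = m≢m′ (unique-small x∉H x∈Sₘ x∈Sₘ′)

      module BothContained (Sⱼ⊆C : Contained j) where

        W : Subspace (6 + k)
        W = D s +⟨ b₀ ⟩

        b₀∉H : b₀ ∉ H
        b₀∉H = ∉-⊕ H (apex∉H s) (K⊆H _ (shift∈K s))

        |W| : count (mem W) ≡ pow 4
        |W| = trans (count-+⟨⟩ (D s) b₀ (b₀∉H ∘ ∈-∩⁻ʳ (U (big s)) H)) (cong (2 *_) (|D| s))

        contained⊆W : ∀ {m} → Contained m → S m ⊆ W
        contained⊆W {m} Sₘ⊆C = let f , f∈S , f∉H = affine-point (small m) in
          ⊆-by-affine-part W (S m) (λ u u∈S u∉H → ∈-+⟨⟩⁺ʳ (D s) b₀ (B⇒b₀+D (S∩C⇒B u∈S (Sₘ⊆C u u∈S u∉H)))) f∈S f∉H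

        B∖Sᵢ⊆Sⱼ : B ∖ᵖ mem (S i) ⊆ᵖ mem (S j)
        B∖Sᵢ⊆Sⱼ = ⊆ᵖ-by-count-∩ _ _ (≤-reflexive (trans |B∖Sᵢ| (sym (trans (count-cong-⇔ to from) (|affine-S| j)))))
          where
          to : B ∖ᵖ mem (S i) ∩ᵖ mem (S j) ⊆ᵖ affine (S j)
          to x x∈ = ∧-true⁺ (∧-true⁻ʳ {(B ∖ᵖ mem (S i)) x} x∈) (not-true⁺ (B⇒∉H (∧-true⁻ˡ (∧-true⁻ˡ x∈))))
          from : affine (S j) ⊆ᵖ B ∖ᵖ mem (S i) ∩ᵖ mem (S j)
          from x x∈ = let x∈S = ∧-true⁻ˡ x∈ ; x∉H = not-true⁻ (∧-true⁻ʳ {mem (S j) x} x∈) in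
            ∧-true⁺ (∧-true⁺ (S∩C⇒B x∈S (Sⱼ⊆C x x∈S x∉H)) (not-true⁺ (∉S-of-other i≢j x∉H x∈S))) x∈S

        covers : ∀ v → v ∈ W → v ∉ H → v ∈ S i ⊎ v ∈ S j
        covers v v∈W v∉H = by-cases (∈-+⟨⟩⁻ (D s) b₀ v∈W) (mem (S i) v ≟ᵇ true)
          where
          by-cases : v ∈ D s ⊎ (v ⊕ b₀) ∈ D s → Dec (v ∈ S i) → v ∈ S i ⊎ v ∈ S j
          by-cases (inj₁ v∈D) _ = ⊥-elim (v∉H (∈-∩⁻ʳ (U (big s)) H v∈D))
          by-cases (inj₂ _) (yes v∈Sᵢ) = inj₁ v∈Sᵢ
          by-cases (inj₂ v⊕b₀∈D) (no v∉Sᵢ) = inj₂ (B∖Sᵢ⊆Sⱼ v (∧-true⁺ (b₀+D⇒B v⊕b₀∈D) (not-true⁺ v∉Sᵢ)))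

        contradiction : ⊥
        contradiction = no-pair-partition W (4 + k) |W| (n≤1+n (5 + k)) (i≢j ∘ small-injective)
          (∈-+⟨self⟩ (D s) b₀) b₀∉H
          (contained⊆W Sᵢ⊆C) (contained⊆W Sⱼ⊆C) covers

      -- With S j meeting the other coset, a nonzero g ∈ G j lies in every member.
      module OneMixed (y′ : Vₙ) (y′∈Sⱼ : y′ ∈ S j) (y′∈C′ : coset (not s) y′ ≡ true) where

        |Gⱼ| : count (mem (G j)) ≡ pow 1
        |Gⱼ| = mixed⇒|G| y₀∈Sⱼ (B⇒C y₀∈B) y′∈Sⱼ y′∈C′

        g-witness : Σ Vₙ λ v → v ∈ G j × v ≢ 0v (6 + k)
        g-witness = nonzero-witness (mem (G j)) (subst (2 ≤_) (sym |Gⱼ|) (*-monoʳ-≤ 2 (m^n>0 2 k)))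

        g : Vₙ
        g = proj₁ g-witness

        g∈K : g ∈ K
        g∈K = ∈-∩⁻ʳ (E j) K (proj₁ (proj₂ g-witness))

        g∈Sⱼ : g ∈ S j
        g∈Sⱼ = ∈-∩⁻ˡ (S j) H (∈-∩⁻ˡ (E j) K (proj₁ (proj₂ g-witness)))

        g∈U : g ∈ U (big s)
        g∈U = meets⇒G⊆U y₀∈Sⱼ (B⇒C y₀∈B) g (proj₁ (proj₂ g-witness))

        g∈U′ : g ∈ U (big (not s))
        g∈U′ = Side′.meets⇒G⊆U y′∈Sⱼ y′∈C′ g (proj₁ (proj₂ g-witness))

        y′∈B′ : Side′.B y′ ≡ true
        y′∈B′ = Side′.S∩C⇒B y′∈Sⱼ y′∈C′

        y′⊕g∈B′ : Side′.B (y′ ⊕ g) ≡ true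
        y′⊕g∈B′ = Side′.S∩C⇒B (∈-⊕ (S j) y′∈Sⱼ g∈Sⱼ) (coset-⊕K (not s) y′∈C′ g∈K)

        y₀⊕g∈B : B (y₀ ⊕ g) ≡ true
        y₀⊕g∈B = S∩C⇒B (∈-⊕ (S j) y₀∈Sⱼ g∈Sⱼ) (coset-⊕K s (B⇒C y₀∈B) g∈K)

        g∈Sᵢ : g ∈ S i
        g∈Sᵢ = ∈-resp-≡ (S i) (⊕-cancelˡ y₀ g)
          (contained-⊕ Sᵢ⊆C y₀∈B y₀⊕g∈B y₀∉Sᵢ (∉S-of-other i≢j (B⇒∉H y₀⊕g∈B) (∈-⊕ (S j) y₀∈Sⱼ g∈Sⱼ)))

        Rᵢⱼ : Pred (6 + k)
        Rᵢⱼ = B ∖ᵖ mem (S i) ∖ᵖ mem (S j)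

        |B∖Sᵢ∩S| : ∀ {m} → i ≢ m → x ∈ S m → C x ≡ true → count (B ∖ᵖ mem (S i) ∩ᵖ mem (S m)) ≡ count (mem (G m))
        |B∖Sᵢ∩S| {m = m} i≢m x∈S x∈C = trans (count-cong-⇔ to from) (|S∩C| x∈S x∈C)
          where
          to : B ∖ᵖ mem (S i) ∩ᵖ mem (S m) ⊆ᵖ mem (S m) ∩ᵖ C
          to v v∈ = ∧-true⁺ (∧-true⁻ʳ {(B ∖ᵖ mem (S i)) v} v∈) (B⇒C (∧-true⁻ˡ (∧-true⁻ˡ v∈)))
          from : mem (S m) ∩ᵖ C ⊆ᵖ B ∖ᵖ mem (S i) ∩ᵖ mem (S m)
          from v v∈ = let v∈S = ∧-true⁻ˡ v∈ ; v∈C = ∧-true⁻ʳ {mem (S m) v} v∈ in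
            ∧-true⁺ (∧-true⁺ (S∩C⇒B v∈S v∈C) (not-true⁺ (∉S-of-other i≢m (coset⇒∉H s v∈C) v∈S))) v∈S

        |Rᵢⱼ| : count Rᵢⱼ ≡ pow 1
        |Rᵢⱼ| = count-∖ (B ∖ᵖ mem (S i)) (mem (S j)) (trans |B∖Sᵢ| (cong (pow 1 +_) (+-identityʳ _)))
                  (trans (|B∖Sᵢ∩S| i≢j y₀∈Sⱼ (B⇒C y₀∈B)) |Gⱼ|)

        z-witness : Σ Vₙ λ v → Rᵢⱼ v ≡ true
        z-witness = count-witness Rᵢⱼ (subst (1 ≤_) (sym |Rᵢⱼ|) (m^n>0 2 (1 + k)))

        z : Vₙ
        z = proj₁ z-witness

        z∈B : B z ≡ true
        z∈B = ∧-true⁻ˡ (∧-true⁻ˡ (proj₂ z-witness))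

        z∉Sᵢ : z ∉ S i
        z∉Sᵢ = not-true⁻ (∧-true⁻ʳ {B z} (∧-true⁻ˡ (proj₂ z-witness)))

        z∉Sⱼ : z ∉ S j
        z∉Sⱼ = not-true⁻ (∧-true⁻ʳ {(B ∖ᵖ mem (S i)) z} (proj₂ z-witness))

        l : Fin 4
        l = proj₁ (B⇒S z∈B)

        z∈Sₗ : z ∈ S l
        z∈Sₗ = proj₂ (B⇒S z∈B)

        Rᵢⱼ⊆Sₗ : Rᵢⱼ ⊆ᵖ mem (S l)
        Rᵢⱼ⊆Sₗ = ⊆ᵖ-by-count-∩ Rᵢⱼ (mem (S l)) (subst (_≤ count (Rᵢⱼ ∩ᵖ mem (S l))) (sym |Rᵢⱼ|)
                   (subst (pow 1 ≤_) (sym (trans (count-cong-⇔ to from) (|S∩C| z∈Sₗ (B⇒C z∈B)))) (pow1≤|G| l)))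
          where
          to : Rᵢⱼ ∩ᵖ mem (S l) ⊆ᵖ mem (S l) ∩ᵖ C
          to v v∈ = ∧-true⁺ (∧-true⁻ʳ {Rᵢⱼ v} v∈) (B⇒C (∧-true⁻ˡ (∧-true⁻ˡ (∧-true⁻ˡ v∈))))
          from : mem (S l) ∩ᵖ C ⊆ᵖ Rᵢⱼ ∩ᵖ mem (S l)
          from v v∈ = let v∈S = ∧-true⁻ˡ v∈ ; v∈C = ∧-true⁻ʳ {mem (S l) v} v∈ ; v∉H = coset⇒∉H s v∈C in
            ∧-true⁺ (∧-true⁺ (∧-true⁺ (S∩C⇒B v∈S v∈C)
              (not-true⁺ (∉S-of-other (λ i≡l → z∉Sᵢ (subst (λ m → z ∈ S m) (sym i≡l) z∈Sₗ)) v∉H v∈S)))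
              (not-true⁺ (∉S-of-other (λ j≡l → z∉Sⱼ (subst (λ m → z ∈ S m) (sym j≡l) z∈Sₗ)) v∉H v∈S))) v∈S

        B⊆Sᵢⱼₗ : B x ≡ true → x ∈ S i ⊎ x ∈ S j ⊎ x ∈ S l
        B⊆Sᵢⱼₗ {x} x∈B = decide (mem (S i) x ≟ᵇ true) (mem (S j) x ≟ᵇ true)
          where
          decide : Dec (x ∈ S i) → Dec (x ∈ S j) → x ∈ S i ⊎ x ∈ S j ⊎ x ∈ S l
          decide (yes x∈Sᵢ) _ = inj₁ x∈Sᵢ
          decide (no _) (yes x∈Sⱼ) = inj₂ (inj₁ x∈Sⱼ)
          decide (no x∉Sᵢ) (no x∉Sⱼ) =
            inj₂ (inj₂ (Rᵢⱼ⊆Sₗ x (∧-true⁺ (∧-true⁺ x∈B (not-true⁺ x∉Sᵢ)) (not-true⁺ x∉Sⱼ))))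

        g∈Sₗ : g ∈ S l
        g∈Sₗ = via-z⊕g (B⊆Sᵢⱼₗ (B⁺ (coset-⊕K s (B⇒C z∈B) g∈K) (B⇒∉U z∈B ∘ ∈-⊕⁻ˡ (U (big s)) g∈U)))
          where
          via-z⊕g : (z ⊕ g) ∈ S i ⊎ (z ⊕ g) ∈ S j ⊎ (z ⊕ g) ∈ S l → g ∈ S l
          via-z⊕g (inj₁ z⊕g∈Sᵢ) = ⊥-elim (z∉Sᵢ (∈-⊕⁻ˡ (S i) g∈Sᵢ z⊕g∈Sᵢ))
          via-z⊕g (inj₂ (inj₁ z⊕g∈Sⱼ)) = ⊥-elim (z∉Sⱼ (∈-⊕⁻ˡ (S j) g∈Sⱼ z⊕g∈Sⱼ))
          via-z⊕g (inj₂ (inj₂ z⊕g∈Sₗ)) = ∈-⊕⁻ʳ (S l) z∈Sₗ z⊕g∈Sₗ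

        g∈S-rest : ∀ m → m ≢ i → m ≢ j → m ≢ l → g ∈ S m
        g∈S-rest m m≢i m≢j m≢l = ∈-resp-≡ (S m) (⊕-cancelˡ y′ g)
          (Side′.contained-⊕ Sₘ⊆C′ y′∈B′ y′⊕g∈B′ (∉S-of-other m≢j (Side′.B⇒∉H y′∈B′) y′∈Sⱼ)
            (∉S-of-other m≢j (Side′.B⇒∉H y′⊕g∈B′) (∈-⊕ (S j) y′∈Sⱼ g∈Sⱼ)))
          where
          Sₘ⊆C′ : Side′.Contained m
          Sₘ⊆C′ x x∈Sₘ x∉H = other-coset (coset-cover s x∉H)
            where
            excluded : x ∈ S i ⊎ x ∈ S j ⊎ x ∈ S l → ⊥
            excluded (inj₁ x∈Sᵢ) = m≢i (unique-small x∉H x∈Sₘ x∈Sᵢ)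
            excluded (inj₂ (inj₁ x∈Sⱼ)) = m≢j (unique-small x∉H x∈Sₘ x∈Sⱼ)
            excluded (inj₂ (inj₂ x∈Sₗ)) = m≢l (unique-small x∉H x∈Sₘ x∈Sₗ)
            other-coset : coset s x ≡ true ⊎ coset (not s) x ≡ true → coset (not s) x ≡ true
            other-coset (inj₁ x∈C) = ⊥-elim (excluded (B⊆Sᵢⱼₗ (S∩C⇒B x∈Sₘ x∈C)))
            other-coset (inj₂ x∈C′) = x∈C′

        g∈all : ∀ m → g ∈ U m
        g∈all = ∀-by-parts s g∈U g∈U′ (∀-by-excluding i j l g∈Sᵢ g∈Sⱼ g∈Sₗ g∈S-rest)

        contradiction : ⊥
        contradiction = proj₂ (proj₂ g-witness) (tight g g∈all)

      contained⇒⊥ : ⊥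
      contained⇒⊥ = by-Sⱼ (⊆ᵖ-or-witness (affine (S j)) C)
        where
        by-Sⱼ : affine (S j) ⊆ᵖ C ⊎ Σ Vₙ (λ v → affine (S j) v ≡ true × ¬ C v ≡ true) → ⊥
        by-Sⱼ (inj₁ Sⱼ⊆C) = BothContained.contradiction λ x x∈S x∉H → Sⱼ⊆C x (∧-true⁺ x∈S (not-true⁺ x∉H))
        by-Sⱼ (inj₂ (y′ , y′∈ , y′∉C)) = by-coset (coset-cover s (not-true⁻ (∧-true⁻ʳ {mem (S j) y′} y′∈)))
          where
          by-coset : coset s y′ ≡ true ⊎ coset (not s) y′ ≡ true → ⊥
          by-coset (inj₁ y′∈C) = y′∉C y′∈C
          by-coset (inj₂ y′∈C′) = OneMixed.contradiction y′ (∧-true⁻ˡ y′∈) y′∈C′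

    Meets : Bool → Fin 4 → Set
    Meets s i = Σ Vₙ λ x → x ∈ S i × coset s x ≡ true

    module Partners (s : Bool) (meets : ∀ i → Meets s i) (meets′ : ∀ i → Meets (not s) i) where
      open Side s

      pt : Fin 4 → Vₙ
      pt i = proj₁ (meets i)

      pt∈S : ∀ i → pt i ∈ S i
      pt∈S i = proj₁ (proj₂ (meets i))

      pt∈C : ∀ i → C (pt i) ≡ true
      pt∈C i = proj₂ (proj₂ (meets i))

      |G|≡ : ∀ i → count (mem (G i)) ≡ pow 1
      |G|≡ i = let x , x∈S , x∈C′ = meets′ i in mixed⇒|G| (pt∈S i) (pt∈C i) x∈S x∈C′

      G⊆J : ∀ i → G i ⊆ J
      G⊆J i g g∈G = let x , x∈S , x∈C′ = meets′ i in
        ∈-J s (meets⇒G⊆U (pt∈S i) (pt∈C i) g g∈G) (Side.meets⇒G⊆U (not s) x∈S x∈C′ g g∈G)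
          (∈-∩⁻ʳ (S i) H (∈-∩⁻ˡ (E i) K g∈G))

      ⊕-∈G : ∀ {u v} → u ∈ S i → C u ≡ true → v ∈ S i → C v ≡ true → (u ⊕ v) ∈ G i
      ⊕-∈G {i} {u} {v} u∈S u∈C v∈S v∈C =
        ∈-∩⁺ (E i) K (∈-∩⁺ (S i) H (∈-⊕ (S i) u∈S v∈S) (⊕-∈H (coset⇒∉H s u∈C) (coset⇒∉H s v∈C)))
          (∈-resp-≡ K (solve ((v₀ ⊞ v₂) ⊞ (v₁ ⊞ v₂)) (v₀ ⊞ v₁) refl (u ∷ v ∷ apex s ∷ [])) (∈-⊕ K u∈C v∈C))

      pt+J⇒C : ∀ {w} → (w ⊕ pt i) ∈ J → C w ≡ true
      pt+J⇒C {i} {w} w⊕p∈J = subst (λ v → C v ≡ true) (trans (⊕-comm _ _) (⊕-cancelʳ (pt i) w))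
        (coset-⊕K s (pt∈C i) (J⊆K _ w⊕p∈J))

      S∩C⊆pt+J : ∀ {w} → w ∈ S i → C w ≡ true → (w ⊕ pt i) ∈ J
      S∩C⊆pt+J {i} w∈S w∈C = G⊆J i _ (⊕-∈G w∈S w∈C (pt∈S i) (pt∈C i))

      record Partner (i : Fin 4) : Set where
        field
          j : Fin 4
          j≢i : j ≢ i
          pt+J⊆ : ∀ w → (w ⊕ pt i) ∈ J → w ∈ S i ⊎ w ∈ S j
          S∩C⊆pt+J′ : ∀ {w} → w ∈ S j → C w ≡ true → (w ⊕ pt i) ∈ J
          G⊆S : G i ⊆ S j

      module PartnerOf (i : Fin 4) where


        |J∖G| : count (mem J ∖ᵖ mem (G i)) ≡ pow 1
        |J∖G| = count-∖ (mem J) (mem (G i)) (trans |J| (cong (pow 1 +_) (+-identityʳ _)))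
          (trans (count-cong-⇔ (λ v → ∧-true⁻ʳ {mem J v}) (λ v v∈G → ∧-true⁺ (G⊆J i v v∈G) v∈G)) (|G|≡ i))

        t-witness : Σ Vₙ λ v → (mem J ∖ᵖ mem (G i)) v ≡ true
        t-witness = count-witness _ (subst (1 ≤_) (sym |J∖G|) (m^n>0 2 (1 + k)))

        t : Vₙ
        t = proj₁ t-witness

        t∈J : t ∈ J
        t∈J = ∧-true⁻ˡ (proj₂ t-witness)

        t∉Sᵢ : t ∉ S i
        t∉Sᵢ t∈S = not-true⁻ (∧-true⁻ʳ {mem J t} (proj₂ t-witness))
          (∈-∩⁺ (E i) K (∈-∩⁺ (S i) H t∈S (J⊆H t t∈J)) (J⊆K t t∈J))

        z : Vₙ
        z = pt i ⊕ t

        z∈B : B z ≡ true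
        z∈B = B⁺ (coset-⊕K s (pt∈C i) (J⊆K t t∈J))
          λ z∈U → big≢small s i (unique (coset⇒∉H s (pt∈C i)) (∈-⊕⁻ˡ (U (big s)) (J⊆U s t t∈J) z∈U) (pt∈S i))

        j : Fin 4
        j = proj₁ (B⇒S z∈B)

        z∈Sⱼ : z ∈ S j
        z∈Sⱼ = proj₂ (B⇒S z∈B)

        z∉Sᵢ : z ∉ S i
        z∉Sᵢ z∈Sᵢ = t∉Sᵢ (∈-⊕⁻ʳ (S i) (pt∈S i) z∈Sᵢ)

        j≢i : j ≢ i
        j≢i j≡i = z∉Sᵢ (subst (λ m → z ∈ S m) j≡i z∈Sⱼ)

        S∩C⊆pt+J′ : ∀ {w} → w ∈ S j → C w ≡ true → (w ⊕ pt i) ∈ J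
        S∩C⊆pt+J′ {w} w∈S w∈C = ∈-resp-≡ J (solve ((v₀ ⊞ (v₁ ⊞ v₂)) ⊞ v₂) (v₀ ⊞ v₁) refl (w ∷ pt i ∷ t ∷ []))
          (∈-⊕ J (G⊆J j _ (⊕-∈G w∈S w∈C z∈Sⱼ (B⇒C z∈B))) t∈J)

        Q : Pred (6 + k)
        Q w = mem J (w ⊕ pt i)

        |S∩C|≡ : ∀ {m} → x ∈ S m → C x ≡ true → count (mem (S m) ∩ᵖ C) ≡ pow 1
        |S∩C|≡ {m = m} x∈S x∈C = trans (|S∩C| x∈S x∈C) (|G|≡ m)

        |Q∖Sᵢ| : count (Q ∖ᵖ mem (S i)) ≡ pow 1
        |Q∖Sᵢ| = count-∖ Q (mem (S i))
          (trans (count-translate (mem J) (pt i)) (trans |J| (cong (pow 1 +_) (+-identityʳ _))))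
          (trans (count-cong-⇔ to from) (|S∩C|≡ (pt∈S i) (pt∈C i)))
          where
          to : Q ∩ᵖ mem (S i) ⊆ᵖ mem (S i) ∩ᵖ C
          to w w∈ = ∧-true⁺ (∧-true⁻ʳ {Q w} w∈) (pt+J⇒C (∧-true⁻ˡ w∈))
          from : mem (S i) ∩ᵖ C ⊆ᵖ Q ∩ᵖ mem (S i)
          from w w∈ = ∧-true⁺ (S∩C⊆pt+J (∧-true⁻ˡ w∈) (∧-true⁻ʳ {mem (S i) w} w∈)) (∧-true⁻ˡ w∈)

        Q∖Sᵢ⊆Sⱼ : Q ∖ᵖ mem (S i) ⊆ᵖ mem (S j)
        Q∖Sᵢ⊆Sⱼ = ⊆ᵖ-by-count-∩ _ _
          (≤-reflexive (trans |Q∖Sᵢ| (sym (trans (count-cong-⇔ to from) (|S∩C|≡ z∈Sⱼ (B⇒C z∈B))))))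
          where
          to : Q ∖ᵖ mem (S i) ∩ᵖ mem (S j) ⊆ᵖ mem (S j) ∩ᵖ C
          to w w∈ = ∧-true⁺ (∧-true⁻ʳ {(Q ∖ᵖ mem (S i)) w} w∈) (pt+J⇒C (∧-true⁻ˡ (∧-true⁻ˡ w∈)))
          from : mem (S j) ∩ᵖ C ⊆ᵖ Q ∖ᵖ mem (S i) ∩ᵖ mem (S j)
          from w w∈ = let w∈S = ∧-true⁻ˡ w∈ ; w∈C = ∧-true⁻ʳ {mem (S j) w} w∈ in
            ∧-true⁺ (∧-true⁺ (S∩C⊆pt+J′ w∈S w∈C)
              (not-true⁺ λ w∈Sᵢ → j≢i (unique-small (coset⇒∉H s w∈C) w∈S w∈Sᵢ))) w∈S

        pt+J⊆ : ∀ w → (w ⊕ pt i) ∈ J → w ∈ S i ⊎ w ∈ S j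
        pt+J⊆ w w∈Q = decide (mem (S i) w ≟ᵇ true)
          where
          decide : Dec (w ∈ S i) → w ∈ S i ⊎ w ∈ S j
          decide (yes w∈Sᵢ) = inj₁ w∈Sᵢ
          decide (no w∉Sᵢ) = inj₂ (Q∖Sᵢ⊆Sⱼ w (∧-true⁺ w∈Q (not-true⁺ w∉Sᵢ)))

        G⊆S : G i ⊆ S j
        G⊆S g g∈G = via-z⊕g (pt+J⊆ (z ⊕ g)
          (∈-resp-≡ J (solve (v₁ ⊞ v₂) (((v₀ ⊞ v₁) ⊞ v₂) ⊞ v₀) refl (pt i ∷ t ∷ g ∷ []))
                         (∈-⊕ J t∈J (G⊆J i g g∈G))))
          where
          via-z⊕g : (z ⊕ g) ∈ S i ⊎ (z ⊕ g) ∈ S j → g ∈ S j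
          via-z⊕g (inj₁ z⊕g∈Sᵢ) = ⊥-elim (z∉Sᵢ (∈-⊕⁻ˡ (S i) (∈-∩⁻ˡ (S i) H (∈-∩⁻ˡ (E i) K g∈G)) z⊕g∈Sᵢ))
          via-z⊕g (inj₂ z⊕g∈Sⱼ) = ∈-⊕⁻ʳ (S j) z∈Sⱼ z⊕g∈Sⱼ

      partner : ∀ i → Partner i
      partner i = record { j = j ; j≢i = j≢i ; pt+J⊆ = pt+J⊆ ; S∩C⊆pt+J′ = S∩C⊆pt+J′ ; G⊆S = G⊆S }
        where open PartnerOf i

    module MixedCase (meets : ∀ s i → Meets s i) where
      module P = Partners false (meets false) (meets true)
      module P′ = Partners true (meets true) (meets false)

      x₀ x₀′ : Vₙ
      x₀ = P.pt zero
      x₀′ = P′.pt zero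

      x₀∉H : x₀ ∉ H
      x₀∉H = coset⇒∉H false (P.pt∈C zero)

      x₀′∉H : x₀′ ∉ H
      x₀′∉H = coset⇒∉H true (P′.pt∈C zero)

      module Partner₀ = P.Partner (P.partner zero)
      module Partner₀′ = P′.Partner (P′.partner zero)

      j j′ : Fin 4
      j = Partner₀.j
      j′ = Partner₀′.j

      -- If both partners agree, J + x₀ + x₀′ is partitioned by S zero and S j.
      module SamePartner (j≡j′ : j ≡ j′) where

        W₁ W : Subspace (6 + k)
        W₁ = J +⟨ x₀ ⟩
        W = W₁ +⟨ x₀′ ⟩

        x₀′∉W₁ : x₀′ ∉ W₁
        x₀′∉W₁ = by-cases ∘ ∈-+⟨⟩⁻ J x₀
          where
          by-cases : x₀′ ∈ J ⊎ (x₀′ ⊕ x₀) ∈ J → ⊥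
          by-cases (inj₁ x₀′∈J) = x₀′∉H (J⊆H x₀′ x₀′∈J)
          by-cases (inj₂ x₀′⊕x₀∈J) = coset-disjoint false (P.pt∈C zero)
            (subst (λ v → coset true v ≡ true) (⊕-cancelˡ x₀′ x₀) (coset-⊕K true (P′.pt∈C zero) (J⊆K _ x₀′⊕x₀∈J)))

        |W| : count (mem W) ≡ pow 4
        |W| = trans (count-+⟨⟩ W₁ x₀′ x₀′∉W₁)
                (cong (2 *_) (trans (count-+⟨⟩ J x₀ (x₀∉H ∘ J⊆H x₀)) (cong (2 *_) |J|)))

        in-x₀ : ∀ {u} → (u ⊕ x₀) ∈ J → u ∈ W
        in-x₀ {u} u⊕x₀∈J = ∈-+⟨⟩⁺ˡ W₁ x₀′ (∈-+⟨⟩⁺ʳ J x₀ u⊕x₀∈J)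

        in-x₀′ : ∀ {u} → (u ⊕ x₀′) ∈ J → u ∈ W
        in-x₀′ {u} u⊕x₀′∈J = ∈-+⟨⟩⁺ʳ W₁ x₀′ (∈-+⟨⟩⁺ˡ J x₀ u⊕x₀′∈J)

        by-coset : ∀ {u} → u ∉ H →
          (coset false u ≡ true → (u ⊕ x₀) ∈ J) → (coset true u ≡ true → (u ⊕ x₀′) ∈ J) → u ∈ W
        by-coset u∉H on-C on-C′ = Data.Sum.[ in-x₀ ∘ on-C , in-x₀′ ∘ on-C′ ] (coset-cover false u∉H)

        S₀⊆W : S zero ⊆ W
        S₀⊆W = ⊆-by-affine-part W (S zero) (λ u u∈S u∉H → by-coset u∉H (P.S∩C⊆pt+J u∈S) (P′.S∩C⊆pt+J u∈S))
                 (P.pt∈S zero) x₀∉H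

        Sⱼ⊆W : S j ⊆ W
        Sⱼ⊆W = let f , f∈S , f∉H = affine-point (small j) in
          ⊆-by-affine-part W (S j) (λ u u∈S u∉H → by-coset u∉H (Partner₀.S∩C⊆pt+J′ u∈S)
            (Partner₀′.S∩C⊆pt+J′ (subst (λ m → u ∈ S m) j≡j′ u∈S))) f∈S f∉H

        covers : ∀ v → v ∈ W → v ∉ H → v ∈ S zero ⊎ v ∈ S j
        covers v v∈W v∉H = in-W₁ (∈-+⟨⟩⁻ W₁ x₀′ v∈W)
          where
          in-J+x₀ : v ∈ J ⊎ (v ⊕ x₀) ∈ J → v ∈ S zero ⊎ v ∈ S j
          in-J+x₀ (inj₁ v∈J) = ⊥-elim (v∉H (J⊆H v v∈J))
          in-J+x₀ (inj₂ v⊕x₀∈J) = Partner₀.pt+J⊆ v v⊕x₀∈J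
          in-J+x₀′ : (v ⊕ x₀′) ∈ J ⊎ ((v ⊕ x₀′) ⊕ x₀) ∈ J → v ∈ S zero ⊎ v ∈ S j
          in-J+x₀′ (inj₁ v⊕x₀′∈J) =
            Data.Sum.map₂ (subst (λ m → v ∈ S m) (sym j≡j′)) (Partner₀′.pt+J⊆ v v⊕x₀′∈J)
          in-J+x₀′ (inj₂ v⊕x₀′⊕x₀∈J) =
            ⊥-elim (v∉H (∈-⊕⁻ˡ H (⊕-∈H x₀′∉H x₀∉H) (∈-resp-≡ H (⊕-assoc v x₀′ x₀) (J⊆H _ v⊕x₀′⊕x₀∈J))))
          in-W₁ : v ∈ W₁ ⊎ (v ⊕ x₀′) ∈ W₁ → v ∈ S zero ⊎ v ∈ S j
          in-W₁ (inj₁ v∈W₁) = in-J+x₀ (∈-+⟨⟩⁻ J x₀ v∈W₁)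
          in-W₁ (inj₂ v⊕x₀′∈W₁) = in-J+x₀′ (∈-+⟨⟩⁻ J x₀ v⊕x₀′∈W₁)

        contradiction : ⊥
        contradiction =
          no-pair-partition W (4 + k) |W| (n≤1+n (5 + k)) (λ eq → Partner₀.j≢i (sym (small-injective eq)))
            (in-x₀ (∈-resp-≡ J (sym (⊕-self x₀)) (hasZero J))) x₀∉H S₀⊆W Sⱼ⊆W covers

      -- Otherwise a nonzero g ∈ G zero lies in every member.
      module DifferentPartners (j≢j′ : j ≢ j′) where

        module Partnerⱼ′ = P.Partner (P.partner j′)


        t : Fin 4
        t = Partnerⱼ′.j

        j≢0 : j ≢ zero
        j≢0 = Partner₀.j≢i

        j′≢0 : j′ ≢ zero
        j′≢0 = Partner₀′.j≢i

        x₀-coset-avoids : ¬ (P.pt j′ ⊕ x₀) ∈ J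
        x₀-coset-avoids = excluded ∘ Partner₀.pt+J⊆ (P.pt j′)
          where
          excluded : P.pt j′ ∈ S zero ⊎ P.pt j′ ∈ S j → ⊥
          excluded (inj₁ in-S₀) = j′≢0 (unique-small (coset⇒∉H false (P.pt∈C j′)) (P.pt∈S j′) in-S₀)
          excluded (inj₂ in-Sⱼ) = j≢j′ (sym (unique-small (coset⇒∉H false (P.pt∈C j′)) (P.pt∈S j′) in-Sⱼ))

        t≢0 : t ≢ zero
        t≢0 t≡0 = x₀-coset-avoids (∈-resp-≡ J (⊕-comm x₀ (P.pt j′))
          (Partnerⱼ′.S∩C⊆pt+J′ (subst (λ m → x₀ ∈ S m) (sym t≡0) (P.pt∈S zero)) (P.pt∈C zero)))

        t≢j : t ≢ j
        t≢j t≡j = x₀-coset-avoids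
          (∈-resp-≡ J (solve ((v₀ ⊞ v₁) ⊞ (v₀ ⊞ v₂)) (v₁ ⊞ v₂) refl (P.pt j ∷ P.pt j′ ∷ x₀ ∷ []))
          (∈-⊕ J (Partnerⱼ′.S∩C⊆pt+J′ (subst (λ m → P.pt j ∈ S m) (sym t≡j) (P.pt∈S j)) (P.pt∈C j))
                 (Partner₀.S∩C⊆pt+J′ (P.pt∈S j) (P.pt∈C j))))

        g-witness : Σ Vₙ λ v → v ∈ G zero × v ≢ 0v (6 + k)
        g-witness = nonzero-witness (mem (G zero)) (subst (2 ≤_) (sym (P.|G|≡ zero)) (*-monoʳ-≤ 2 (m^n>0 2 k)))

        g : Vₙ
        g = proj₁ g-witness

        g∈G₀ : g ∈ G zero
        g∈G₀ = proj₁ (proj₂ g-witness)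

        g∈J : g ∈ J
        g∈J = P.G⊆J zero g g∈G₀

        g∈Sⱼ′ : g ∈ S j′
        g∈Sⱼ′ = Partner₀′.G⊆S g g∈G₀

        g∈S : ∀ m → g ∈ S m
        g∈S = ∀-by-excluding zero j j′ (∈-∩⁻ˡ (S zero) H (∈-∩⁻ˡ (E zero) K g∈G₀)) (Partner₀.G⊆S g g∈G₀) g∈Sⱼ′
          λ m m≢0 m≢j m≢j′ → subst (λ m → g ∈ S m)
            (sym (fourth-unique zero j j′ m t (j≢0 ∘ sym) (j′≢0 ∘ sym) j≢j′ m≢0 m≢j m≢j′ t≢0 t≢j Partnerⱼ′.j≢i))
            (Partnerⱼ′.G⊆S g (∈-∩⁺ (E j′) K (∈-∩⁺ (S j′) H g∈Sⱼ′ (J⊆H g g∈J)) (J⊆K g g∈J)))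

        g∈all : ∀ m → g ∈ U m
        g∈all = ∀-by-parts false (J⊆U false g g∈J) (J⊆U true g g∈J) g∈S

        contradiction : ⊥
        contradiction = proj₂ (proj₂ g-witness) (tight g g∈all)

      contradiction : ⊥
      contradiction = by-partners (j ≟ᶠ j′)
        where
        by-partners : Dec (j ≡ j′) → ⊥
        by-partners (yes j≡j′) = SamePartner.contradiction j≡j′
        by-partners (no j≢j′) = DifferentPartners.contradiction j≢j′

    contained-or-meets : ∀ s i → Side.Contained s i ⊎ Meets (not s) i
    contained-or-meets s i = by-witness (⊆ᵖ-or-witness (affine (S i)) (coset s))
      where
      by-witness : affine (S i) ⊆ᵖ coset s ⊎ Σ Vₙ (λ v → affine (S i) v ≡ true × ¬ coset s v ≡ true) →
                   Side.Contained s i ⊎ Meets (not s) i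
      by-witness (inj₁ Sᵢ⊆C) = inj₁ λ x x∈S x∉H → Sᵢ⊆C x (∧-true⁺ x∈S (not-true⁺ x∉H))
      by-witness (inj₂ (x , x∈ , x∉C)) =
        inj₂ (x , ∧-true⁻ˡ x∈ , Data.Sum.[ ⊥-elim ∘ x∉C , (λ x∈C′ → x∈C′) ]′
          (coset-cover s (not-true⁻ (∧-true⁻ʳ {mem (S i) x} x∈))))

    contradiction : ⊥
    contradiction = by-sides (∃-or-∀ (contained-or-meets false)) (∃-or-∀ (contained-or-meets true))
      where
      by-sides : Σ (Fin 4) (Side.Contained false) ⊎ (∀ i → Meets true i) →
                 Σ (Fin 4) (Side.Contained true) ⊎ (∀ i → Meets false i) → ⊥
      by-sides (inj₁ (i , Sᵢ⊆C)) _ = ContainedCase.contained⇒⊥ false i Sᵢ⊆C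
      by-sides (inj₂ _) (inj₁ (i , Sᵢ⊆C)) = ContainedCase.contained⇒⊥ true i Sᵢ⊆C
      by-sides (inj₂ meet-true) (inj₂ meet-false) =
        MixedCase.contradiction λ { false → meet-false ; true → meet-true }

  contradiction : ⊥
  contradiction = by-traces (⊆ᵖ-or-witness (mem (D true)) (mem (D false)))
    (⊆ᵖ-or-witness (mem (D false)) (mem (D true)))
    where
    by-traces : D true ⊆ D false ⊎ Σ Vₙ (λ v → v ∈ D true × v ∉ D false) →
                D false ⊆ D true ⊎ Σ Vₙ (λ v → v ∈ D false × v ∉ D true) → ⊥
    by-traces (inj₁ D₁⊆D₀) _ = traces-differ D₁⊆D₀
    by-traces (inj₂ _) (inj₁ D₀⊆D₁) = traces-differ
      (⊆-by-count D₀⊆D₁ (≤-reflexive (trans (|D| true) (sym (|D| false)))))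
    by-traces (inj₂ (d , d∈D₁ , d∉D₀)) (inj₂ (e , e∈D₀ , e∉D₁)) = DistinctTraces.contradiction d d∈D₁ d∉D₀ e e∈D₀ e∉D₁

mainTheorem12 : (n : ℕ) → 6 ≤ n →
    ¬ (Σ (Subspace n) λ H → Σ (Fin 6 → Subspace n) λ U →
         IsAVSP H U ×
         HasDim (U zero) (n ∸ 2) × HasDim (U (suc zero)) (n ∸ 2) ×
         HasDim (U (suc (suc zero))) (n ∸ 3) ×
         HasDim (U (suc (suc (suc zero)))) (n ∸ 3) ×
         HasDim (U (suc (suc (suc (suc zero))))) (n ∸ 3) ×
         HasDim (U (suc (suc (suc (suc (suc zero)))))) (n ∸ 3) ×
         Tight U × Irreducible H U)
mainTheorem12 n (s≤s (s≤s (s≤s (s≤s (s≤s (s≤s (z≤n {k})))))))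
  (H , U , (|H| , _ , _ , members , partition) , |U₀| , |U₁| , |S₀| , |S₁| , |S₂| , |S₃| , tight , irreducible) =
  Counterexample.contradiction k H U (by-count H (5 + k) |H|) (λ i → proj₂ (members i refl)) partition |U| |S|
    tight irreducible
  where
  by-count : ∀ (W : Subspace (6 + k)) d → HasDim W d → count (mem W) ≡ 2 ^ d
  by-count W d dim = trans (sym (card≡count W)) dim
  |U| : ∀ s → count (mem (U (big s))) ≡ 2 ^ (4 + k)
  |U| false = by-count (U zero) (4 + k) |U₀|
  |U| true = by-count (U (suc zero)) (4 + k) |U₁|
  |S| : ∀ i → count (mem (U (small i))) ≡ 2 ^ (3 + k)
  |S| zero = by-count (U (small zero)) (3 + k) |S₀|
  |S| (suc zero) = by-count (U (small (suc zero))) (3 + k) |S₁|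
  |S| (suc (suc zero)) = by-count (U (small (suc (suc zero)))) (3 + k) |S₂|
  |S| (suc (suc (suc zero))) = by-count (U (small (suc (suc (suc zero))))) (3 + k) |S₃|
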